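{- The processor $\mathit{Proc}_{\mathtt{statcrit}}$ that maps a DP problem $(\mathcal P_1\uplus\mathcal P_2,\mathcal R,\mathtt{computable}_{\mathcal U},f)$ to $\{(\mathcal P_2,\mathcal R,\mathtt{computable}_{\mathcal U},f)\}$ if there exists a projection function $\nu$ for $\mathcal P_1\uplus\mathcal P_2$ such that $\overline\nu(\ell)\sqsupset\overline\nu(p)$ for all $\ell\Rrightarrow p\ (A)\in\mathcal P_1$ and $\overline\nu(\ell)=\overline\nu(p)$ for all $\ell\Rrightarrow p\ (A)\in\mathcal P_2$ (and maps every other DP problem $N$ to $\{N\}$) is sound and complete. Here $\sqsupset$ is the relation on base-type (meta-)terms with $s\sqsupset t$ iff $s\ne t$ and either (a) $s\unrhd_{\mathrm{acc}}t$, or (b) there is a meta-variable $Z$ with $s\unrhd_{\mathrm{acc}}Z\langle x_1,\dots,x_k\rangle$ for some variables $x_1,\dots,x_k$ and $t=Z\langle t_1,\dots,t_e\rangle\,s_1\cdots s_n$ for some meta-terms $t_j,s_j$.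
   Context: Basic notions (higher-order rewriting with meta-variables). Types are built from sorts by $\to$. There are disjoint sets of function symbols, variables $\mathcal V$ and meta-variables (each typed; meta-variables $Z$ have an arity; infinitely many variables and meta-variables of each type). Meta-terms are built from variables, function symbols, application $s\,t$, abstraction $\lambda x.s$ and meta-variable applications $Z\langle s_1,..,s_k\rangle$ ($k=\mathit{arity}(Z)$), all well-typed; terms are meta-terms without meta-variables; modulo $\alpha$; $FV,FMV$ = free variables, meta-variables; closed = no free variables. A pattern is $Z\langle x_1..x_k\rangle$ (distinct variables), $\lambda x.\ell$, or $a\,\ell_1\cdots\ell_n$ with $a$ a function symbol or variable. Substitutions map variables/meta-variables to (meta-)terms; $Z\langle s_1..s_k\rangle\gamma=u[x_1:=s_1\gamma..x_n:=s_n\gamma](s_{n+1}\gamma)\cdots(s_k\gamma)$ if $\gamma(Z)=\lambda x_1..x_n.u$ ($n=k$, or $n<k$ and $u$ not an abstraction), otherwise substitution is homomorphic and capture-avoiding. A rule is $\ell\Rightarrow r$ with $\ell,r$ closed meta-terms of the same type, $\ell$ a pattern $\mathsf f\,\ell_1\cdots\ell_n$, $FMV(r)\subseteq FMV(\ell)$. $\to_{\mathcal R}$ is the closure under all contexts of $\ell\delta\to r\delta$ ($\ell\Rightarrow r\in\mathcal R$, $\mathrm{dom}(\delta)=FMV(\ell)$) and $\beta$: $(\lambda x.s)t\to s[x:=t]$. The signature used for terms contains marked symbols $\mathsf f^\sharp$, and for each type countably many symbols not used in the rules. Accessibility: fix a quasi-ordering $\succeq$ on sorts with well-founded strict part $\succ$;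 for $\sigma=\sigma_1\to..\to\sigma_m\to\kappa$ and sort $\iota$: $\iota\succeq_+\sigma$ iff $\iota\succeq\kappa$ and $\iota\succ_-\sigma_i$ for all $i$; $\iota\succ_-\sigma$ iff $\iota\succ\kappa$ and $\iota\succeq_+\sigma_i$ for all $i$. For a function symbol $\mathsf f:\sigma_1\to..\to\sigma_m\to\iota$, $\mathit{Acc}(\mathsf f)=\{i\mid\iota\succeq_+\sigma_i\}$; for $x\in\mathcal V$ of that type, $\mathit{Acc}(x)=\{i\mid\sigma_i=\tau_1\to..\to\tau_n\to\kappa,\ \iota\succeq\kappa\}$. $s\unrhd_{\mathrm{acc}}t$ iff $s=t$, or $s=\lambda x.s'$ with $s'\unrhd_{\mathrm{acc}}t$, or $s=a\,s_1\cdots s_n$ with $a$ a function symbol or variable and $s_i\unrhd_{\mathrm{acc}}t$ for some $i\in\mathit{Acc}(a)$ with $a\notin FV(s_i)$. Dependency pairs: a DP is a triple $\ell\Rrightarrow p\ (A)$ with $\ell$ a closed pattern $\mathsf f\,\ell_1\cdots\ell_k$, $p$ a closed meta-term $\mathsf g\,p_1\cdots p_n$, $A$ a set of conditions $Z:i$; conservative if $FMV(p)\subseteq FMV(\ell)$. $\gamma$ respects $A$ if for all $Z:i\in A$, $\gamma(Z)=\lambda x_1..x_j.t$ with $i>j$ or ($i\le j$ and $x_i\in FV(t)$). $s\trianglerighteq^\beta_A t$: $s=t$; or $s=\lambda x.u$, $u\trianglerighteq^\beta_A t$; or $s=(\lambda x.u)s_0\cdots s_n$ and some $s_i\trianglerighteq^\beta_At$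 or $u[x:=s_0]s_1\cdots s_n\trianglerighteq^\beta_At$; or $s=a\,s_1\cdots s_n$ ($a$ function symbol or variable) and some $s_i\trianglerighteq^\beta_At$; or $s=Z\langle t_1..t_e\rangle s_1\cdots s_n$ and some $s_i\trianglerighteq^\beta_At$, or some $t_i\trianglerighteq^\beta_At$ with $(Z:i)\in A$. Chains: a $(\mathcal P,\mathcal R)$-chain is a finite or infinite sequence $[(\ell_0\Rrightarrow p_0(A_0),s_0,t_0),\dots]$ of DPs in $\mathcal P$ and terms such that for all $i$ some substitution $\gamma_i$ on domain $FMV(\ell_i)\cup FMV(p_i)$ respecting $A_i$ has $s_i=\ell_i\gamma_i,t_i=p_i\gamma_i$, and $t_i=\mathsf f\,u_1\cdots u_n$, $s_{i+1}=\mathsf f\,w_1\cdots w_n$ with $u_j\to^*_{\mathcal R}w_j$. Minimal: strict subterms of all $t_i$ are $\to_{\mathcal R}$-terminating. For rules $\mathcal U$, an RC-set is a set $I$ of base-type terms, all $\to_{\mathcal U}$-terminating, closed under $\to_{\mathcal U}$, containing each $x\,s_1..s_n$ ($x\in\mathcal V$) or $(\lambda x.u)s_0..s_n$ whose reducts all lie in $I$; $I$-computable: base-type terms in $I$, and $s:\sigma\to\tau$ with $s\,t$ $I$-computable for all $I$-computable $t$. $\mathsf f\,s_1..s_m\rightsquigarrow_I s_i\,t_1..t_n$ if both sides have base type, $i\in\mathit{Acc}(\mathsf f)$, all $t_j$ $I$-computable. $C_{\mathcal U}$ is an RC-set with $C_{\mathcal U}=\{s$ base type, terminating under $\to_{\mathcal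 U}\cup\rightsquigarrow_{C_{\mathcal U}}$, with $s\to^*_{\mathcal U}\mathsf f\,s_1..s_m$ implying $s_i$ $C_{\mathcal U}$-computable for $i\in\mathit{Acc}(\mathsf f)\}$. A chain is $\mathcal U$-computable if $\to_{\mathcal U}\supseteq\to_{\mathcal R}$ and for all $i$, $(\lambda x_1..x_n.v)\gamma_i$ is $C_{\mathcal U}$-computable whenever $p_i\trianglerighteq^\beta_Bv$, $\gamma_i$ respects $B$, $FV(v)=\{x_1..x_n\}$. Formative: a reduction $s\to^*_{\mathcal R}\ell\gamma$ is $\ell$-formative if inductively: $\ell$ is not fully extended linear (a meta-variable occurs twice, or $\ell$ has a sub-meta-term $\lambda x.C[Z\langle\vec s\rangle]$ with $x\notin\vec s$); or $\ell=Z\langle\vec x\rangle$ and $s=\ell\gamma$; or $s=a\,s_1..s_n$, $\ell=a\,\ell_1..\ell_n$ ($a$ a (marked) function symbol or variable) with $s_i\to^*\ell_i\gamma$ $\ell_i$-formative; or $s=\lambda x.s'$, $\ell=\lambda x.\ell'$, $s'\to^*\ell'\gamma$ $\ell'$-formative; or $s=(\lambda x.u)v\,w_1..w_n$ and $u[x:=v]w_1..w_n\to^*\ell\gamma$ $\ell$-formative; or $\ell$ is not a meta-variable application and there are a rule $\ell'\Rightarrow r'$, meta-variables $Z_1..Z_n$, $\delta$ with $s\to^*(\ell'Z_1..Z_n)\delta$ $(\ell'Z_1..Z_n)$-formative and $(r'Z_1..Z_n)\delta\to^*\ell\gamma$ $\ell$-formative. A chain is formative if each $t_i\to^*_{\mathcal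 R}s_{i+1}$ is $\ell_{i+1}$-formative. DP problems: $(\mathcal P,\mathcal R,m,f)$ with $m\in\{\mathtt{minimal},\mathtt{arbitrary}\}\cup\{\mathtt{computable}_{\mathcal U}\}$, $f\in\{\mathtt{formative},\mathtt{all}\}$. Finite: no infinite $(\mathcal P,\mathcal R)$-chain that is $\mathcal U$-computable if $m=\mathtt{computable}_{\mathcal U}$, minimal if $m=\mathtt{minimal}$, formative if $f=\mathtt{formative}$. Infinite: $\to_{\mathcal R}$ non-terminating or an infinite $(\mathcal P,\mathcal R)$-chain with only conservative DPs exists. A processor maps a DP problem to NO or a set of DP problems; sound if $M$ is finite whenever $\mathit{Proc}(M)\ne$ NO and all its elements are finite; complete if $M$ is infinite whenever $\mathit{Proc}(M)=$ NO or contains an infinite element. Projection functions: $\mathtt{heads}(\mathcal P)$ is the set of symbols occurring as head of a left- or right-hand side of a DP in $\mathcal P$; a projection function is $\nu:\mathtt{heads}(\mathcal P)\to\mathbb N$ such that $\overline\nu(\mathsf f\,s_1\cdots s_n)=s_{\nu(\mathsf f)}$ is well-defined on both sides of every DP in $\mathcal P$. -}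

module Defs where

open import Data.Nat using (ℕ; zero; suc; _≟_)
open import Data.List using (List; []; _∷_; _++_; [_]; foldr; map)
open import Data.List.Relation.Unary.Any using (Any)
open import Data.List.Relation.Unary.All using (All)
open import Data.List.Relation.Unary.Unique.Propositional using (Unique)
open import Data.List.Relation.Binary.Pointwise using (Pointwise)
open import Data.List.Membership.Propositional using (_∈_)
open import Data.Maybe using (Maybe; just; nothing)
open import Data.Product using (Σ; ∃; _×_; _,_; proj₁; proj₂)
open import Data.Sum using (_⊎_; inj₁; inj₂)
open import Data.Empty using (⊥)
open import Data.Unit using (⊤)
open import Relation.Nullary using (¬_; yes; no)
open import Relation.Binary.PropositionalEquality using (_≡_; _≢_; refl)
open import Relation.Binary.Structures using (IsPreorder)
open import Relation.Binary.Construct.Closure.ReflexiveTransitive using (Star)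
open import Induction.WellFounded using (WellFounded; Acc)
open import Function.Bundles using (_⇔_)

infixr 5 _⇒_
data Ty (S : Set) : Set where
  base : S → Ty S
  _⇒_  : Ty S → Ty S → Ty S

record Sig : Set₁ where
  field
    Sort          : Set
    _⪰_           : Sort → Sort → Set
    ⪰-isPreorder  : IsPreorder _≡_ _⪰_
    -- the strict part  a ≻ b  :=  a ⪰ b ∧ ¬ b ⪰ a  is well-founded
    ≻-wellFounded : WellFounded (λ a b → (b ⪰ a) × ¬ (a ⪰ b))
    Sym           : Set
    symTy         : Sym → Ty Sort
    varTy         : ℕ → Ty Sort
    varTy-inf     : ∀ σ → Σ (ℕ → ℕ) λ g →
                      (∀ {m n} → g m ≡ g n → m ≡ n) × (∀ n → varTy (g n) ≡ σ)

module Framework (Sg : Sig) where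
  open Sig Sg

  Type : Set
  Type = Ty Sort

  _⇒*_ : List Type → Type → Type
  as ⇒* r = foldr _⇒_ r as

  argTys : Type → List Type
  argTys (base _) = []
  argTys (σ ⇒ τ) = σ ∷ argTys τ

  resSort : Type → Sort
  resSort (base ι) = ι
  resSort (σ ⇒ τ) = resSort τ

  -- 1-based lookup:  lookup1 [a₁,…,aₙ] i = just aᵢ  (1 ≤ i ≤ n)
  lookup1 : {A : Set} → List A → ℕ → Maybe A
  lookup1 _ zero = nothing
  lookup1 [] (suc _) = nothing
  lookup1 (a ∷ _) (suc zero) = just a
  lookup1 (_ ∷ as) (suc (suc i)) = lookup1 as (suc i)

  record MV : Set where
    constructor mvar
    field
      name  : ℕ
      margs : List Type
      mres  : Type

  mvTy : MV → Type
  mvTy Z = MV.margs Z ⇒* MV.mres Z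

  -- Meta-terms, locally nameless: free variables are named (fv), bound
  -- variables are de Bruijn indices (bv); α-equivalent meta-terms are
  -- syntactically equal.

  data _∋_ : List Type → Type → Set where
    vz : ∀ {Γ σ} → (σ ∷ Γ) ∋ σ
    vs : ∀ {Γ σ τ} → Γ ∋ σ → (τ ∷ Γ) ∋ σ

  data Tm (Γ : List Type) : Type → Set
  data Args (Γ : List Type) : List Type → Set

  data Tm Γ where
    fv   : (x : ℕ) → Tm Γ (varTy x)
    bv   : ∀ {σ} → Γ ∋ σ → Tm Γ σ
    con  : (f : Sym) → Tm Γ (symTy f)
    app  : ∀ {σ τ} → Tm Γ (σ ⇒ τ) → Tm Γ σ → Tm Γ τ
    lam  : ∀ {σ τ} → Tm (σ ∷ Γ) τ → Tm Γ (σ ⇒ τ)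
    meta : (Z : MV) → Args Γ (MV.margs Z) → Tm Γ (MV.mres Z)

  data Args Γ where
    []ₐ  : Args Γ []
    _∷ₐ_ : ∀ {σ as} → Tm Γ σ → Args Γ as → Args Γ (σ ∷ as)

  TmΣ : List Type → Set
  TmΣ Γ = Σ Type (Tm Γ)

  argList : ∀ {Γ as} → Args Γ as → List (TmΣ Γ)
  argList []ₐ = []
  argList (t ∷ₐ ts) = (_ , t) ∷ argList ts

  Ren : List Type → List Type → Set
  Ren Γ Δ = ∀ {σ} → Γ ∋ σ → Δ ∋ σ

  liftR : ∀ {Γ Δ σ} → Ren Γ Δ → Ren (σ ∷ Γ) (σ ∷ Δ)
  liftR ρ vz = vz
  liftR ρ (vs x) = vs (ρ x)

  ren  : ∀ {Γ Δ τ} → Ren Γ Δ → Tm Γ τ → Tm Δ τ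
  renA : ∀ {Γ Δ as} → Ren Γ Δ → Args Γ as → Args Δ as
  ren ρ (fv x) = fv x
  ren ρ (bv x) = bv (ρ x)
  ren ρ (con f) = con f
  ren ρ (app s t) = app (ren ρ s) (ren ρ t)
  ren ρ (lam t) = lam (ren (liftR ρ) t)
  ren ρ (meta Z ts) = meta Z (renA ρ ts)
  renA ρ []ₐ = []ₐ
  renA ρ (t ∷ₐ ts) = ren ρ t ∷ₐ renA ρ ts

  Sub : List Type → List Type → Set
  Sub Γ Δ = ∀ {σ} → Γ ∋ σ → Tm Δ σ

  liftS : ∀ {Γ Δ σ} → Sub Γ Δ → Sub (σ ∷ Γ) (σ ∷ Δ)
  liftS θ vz = bv vz
  liftS θ (vs x) = ren vs (θ x)

  sub  : ∀ {Γ Δ τ} → Sub Γ Δ → Tm Γ τ → Tm Δ τ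
  subA : ∀ {Γ Δ as} → Sub Γ Δ → Args Γ as → Args Δ as
  sub θ (fv x) = fv x
  sub θ (bv x) = θ x
  sub θ (con f) = con f
  sub θ (app s t) = app (sub θ s) (sub θ t)
  sub θ (lam t) = lam (sub (liftS θ) t)
  sub θ (meta Z ts) = meta Z (subA θ ts)
  subA θ []ₐ = []ₐ
  subA θ (t ∷ₐ ts) = sub θ t ∷ₐ subA θ ts

  _▸_ : ∀ {Γ Δ σ} → Sub Γ Δ → Tm Δ σ → Sub (σ ∷ Γ) Δ
  (θ ▸ s) vz = s
  (θ ▸ s) (vs x) = θ x

  emptyS : ∀ {Δ} → Sub [] Δ
  emptyS ()

  _[0:=_] : ∀ {Γ σ τ} → Tm (σ ∷ Γ) τ → Tm Γ σ → Tm Γ τ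
  u [0:= s ] = sub (bv ▸ s) u

  fvAt : ∀ {Γ σ} (x : ℕ) → varTy x ≡ σ → Tm Γ σ
  fvAt x refl = fv x

  -- abstracting the free variable x:  close x t  is the body of λx.t
  closeG : ∀ {Γ Δ τ} (x : ℕ) → Ren Γ Δ → Δ ∋ varTy x → Tm Γ τ → Tm Δ τ
  closeGA : ∀ {Γ Δ as} (x : ℕ) → Ren Γ Δ → Δ ∋ varTy x → Args Γ as → Args Δ as
  closeG x ρ v (fv y) with x ≟ y
  ... | yes refl = bv v
  ... | no _ = fv y
  closeG x ρ v (bv p) = bv (ρ p)
  closeG x ρ v (con f) = con f
  closeG x ρ v (app s t) = app (closeG x ρ v s) (closeG x ρ v t)
  closeG x ρ v (lam t) = lam (closeG x (liftR ρ) (vs v) t)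
  closeG x ρ v (meta Z ts) = meta Z (closeGA x ρ v ts)
  closeGA x ρ v []ₐ = []ₐ
  closeGA x ρ v (t ∷ₐ ts) = closeG x ρ v t ∷ₐ closeGA x ρ v ts

  close : ∀ {Γ τ} (x : ℕ) → Tm Γ τ → Tm (varTy x ∷ Γ) τ
  close x t = closeG x vs vz t

  closeAll : ∀ {τ} (xs : List ℕ) → Tm [] τ → Tm [] (map varTy xs ⇒* τ)
  closeAll [] v = v
  closeAll (x ∷ xs) v = lam (close x (closeAll xs v))

  -- Meta-substitutions (on meta-variables) and their application:
  -- Z⟨s₁…sₖ⟩γ = u[x₁:=s₁γ…xₙ:=sₙγ](sₙ₊₁γ)⋯(sₖγ) where γ(Z)=λx₁…xₙ.u
  -- with n = k, or n < k and u not an abstraction.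

  MSub : Set
  MSub = (Z : MV) → Tm [] (mvTy Z)

  apps : ∀ {Γ as r} → Tm Γ (as ⇒* r) → Args Γ as → Tm Γ r
  apps t []ₐ = t
  apps t (s ∷ₐ ss) = apps (app t s) ss

  data LamView {Δ} : ∀ {σ} → Tm Δ σ → Set where
    isLam  : ∀ {σ τ} (u : Tm (σ ∷ Δ) τ) → LamView (lam u)
    notLam : ∀ {σ} {t : Tm Δ σ} → LamView t

  lamView : ∀ {Δ σ} (t : Tm Δ σ) → LamView t
  lamView (lam u) = isLam u
  lamView t = notLam

  inst : ∀ {Γ Δ} (as : List Type) {r : Type} → Tm Δ (as ⇒* r) → Sub Δ Γ → Args Γ as → Tm Γ r
  inst [] t θ []ₐ = sub θ t
  inst (a ∷ as) t θ (s ∷ₐ ss) with lamView t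
  ... | isLam u = inst as u (θ ▸ s) ss
  ... | notLam = apps (sub θ t) (s ∷ₐ ss)

  _⟪_⟫  : ∀ {Γ τ} → Tm Γ τ → MSub → Tm Γ τ
  _⟪_⟫A : ∀ {Γ as} → Args Γ as → MSub → Args Γ as
  fv x ⟪ γ ⟫ = fv x
  bv x ⟪ γ ⟫ = bv x
  con f ⟪ γ ⟫ = con f
  app s t ⟪ γ ⟫ = app (s ⟪ γ ⟫) (t ⟪ γ ⟫)
  lam t ⟪ γ ⟫ = lam (t ⟪ γ ⟫)
  meta Z ts ⟪ γ ⟫ = inst (MV.margs Z) (γ Z) emptyS (ts ⟪ γ ⟫A)
  []ₐ ⟪ γ ⟫A = []ₐ
  (t ∷ₐ ts) ⟪ γ ⟫A = (t ⟪ γ ⟫) ∷ₐ (ts ⟪ γ ⟫A)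

  data FVin (x : ℕ) : ∀ {Γ τ} → Tm Γ τ → Set where
    fv-here : ∀ {Γ} → FVin x {Γ} (fv x)
    fv-appl : ∀ {Γ σ τ} {s : Tm Γ (σ ⇒ τ)} {t} → FVin x s → FVin x (app s t)
    fv-appr : ∀ {Γ σ τ} {s : Tm Γ (σ ⇒ τ)} {t} → FVin x t → FVin x (app s t)
    fv-lam  : ∀ {Γ σ τ} {t : Tm (σ ∷ Γ) τ} → FVin x t → FVin x (lam t)
    fv-arg  : ∀ {Γ Z} {ts : Args Γ (MV.margs Z)} →
              Any (λ p → FVin x (proj₂ p)) (argList ts) → FVin x (meta Z ts)

  -- occurrence (position) of the meta-variable Z; Z ∈ FMV(t) iff inhabited
  data MetaPos (Z : MV) : ∀ {Γ τ} → Tm Γ τ → Set where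
    mp-here : ∀ {Γ} {ts : Args Γ (MV.margs Z)} → MetaPos Z (meta Z ts)
    mp-appl : ∀ {Γ σ τ} {s : Tm Γ (σ ⇒ τ)} {t} → MetaPos Z s → MetaPos Z (app s t)
    mp-appr : ∀ {Γ σ τ} {s : Tm Γ (σ ⇒ τ)} {t} → MetaPos Z t → MetaPos Z (app s t)
    mp-lam  : ∀ {Γ σ τ} {t : Tm (σ ∷ Γ) τ} → MetaPos Z t → MetaPos Z (lam t)
    mp-arg  : ∀ {Γ Y} {ts : Args Γ (MV.margs Y)} →
              Any (λ p → MetaPos Z (proj₂ p)) (argList ts) → MetaPos Z (meta Y ts)

  data OccBV : ∀ {Γ σ τ} → Γ ∋ σ → Tm Γ τ → Set where
    ob-here : ∀ {Γ σ} {x : Γ ∋ σ} → OccBV x (bv x)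
    ob-appl : ∀ {Γ ρ σ τ} {x : Γ ∋ ρ} {s : Tm Γ (σ ⇒ τ)} {t} → OccBV x s → OccBV x (app s t)
    ob-appr : ∀ {Γ ρ σ τ} {x : Γ ∋ ρ} {s : Tm Γ (σ ⇒ τ)} {t} → OccBV x t → OccBV x (app s t)
    ob-lam  : ∀ {Γ ρ σ τ} {x : Γ ∋ ρ} {t : Tm (σ ∷ Γ) τ} → OccBV (vs x) t → OccBV x (lam t)
    ob-arg  : ∀ {Γ ρ Z} {x : Γ ∋ ρ} {ts : Args Γ (MV.margs Z)} →
              Any (λ p → OccBV x (proj₂ p)) (argList ts) → OccBV x (meta Z ts)

  data SymIn (f : Sym) : ∀ {Γ τ} → Tm Γ τ → Set where
    sy-here : ∀ {Γ} → SymIn f {Γ} (con f)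
    sy-appl : ∀ {Γ σ τ} {s : Tm Γ (σ ⇒ τ)} {t} → SymIn f s → SymIn f (app s t)
    sy-appr : ∀ {Γ σ τ} {s : Tm Γ (σ ⇒ τ)} {t} → SymIn f t → SymIn f (app s t)
    sy-lam  : ∀ {Γ σ τ} {t : Tm (σ ∷ Γ) τ} → SymIn f t → SymIn f (lam t)
    sy-arg  : ∀ {Γ Z} {ts : Args Γ (MV.margs Z)} →
              Any (λ p → SymIn f (proj₂ p)) (argList ts) → SymIn f (meta Z ts)

  Closed : ∀ {Γ τ} → Tm Γ τ → Set
  Closed t = ∀ x → ¬ FVin x t

  -- a term is a meta-term without meta-variables
  NoMeta : ∀ {Γ τ} → Tm Γ τ → Set
  NoMeta t = ∀ Z → ¬ MetaPos Z t

  TermSub : MSub → Set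
  TermSub γ = ∀ Z → NoMeta (γ Z)

  spine : ∀ {Γ τ} → Tm Γ τ → TmΣ Γ × List (TmΣ Γ)
  spine (app s t) = proj₁ (spine s) , (proj₂ (spine s) ++ [ (_ , t) ])
  spine t = (_ , t) , []

  data IsFunHd {Γ} : TmΣ Γ → Set where
    isFun : ∀ {f} → IsFunHd (_ , con f)

  data IsFV {Γ} : TmΣ Γ → Set where
    isFV : ∀ {x} → IsFV (_ , fv x)

  AllFV : ∀ {Γ as} → Args Γ as → Set
  AllFV ts = All IsFV (argList ts)

  data IsMetaApp {Γ} : ∀ {τ} → Tm Γ τ → Set where
    isMeta : ∀ {Z ts} → IsMetaApp (meta Z ts)

  varId : ∀ {Γ σ} → Tm Γ σ → Maybe (ℕ ⊎ ℕ)
  varId (fv x) = just (inj₂ x)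
  varId (bv p) = just (inj₁ (idx p))
    where
      idx : ∀ {Γ σ} → Γ ∋ σ → ℕ
      idx vz = zero
      idx (vs q) = suc (idx q)
  varId _ = nothing

  DistinctVars : ∀ {Γ as} → Args Γ as → Set
  DistinctVars ts = Σ (List (ℕ ⊎ ℕ)) λ ids →
    Pointwise (λ p i → varId (proj₂ p) ≡ just i) (argList ts) ids × Unique ids

  data Pat : ∀ {Γ σ} → Tm Γ σ → Set
  data PatSp : ∀ {Γ σ} → Tm Γ σ → Set
  data Pat where
    p-meta : ∀ {Γ Z} {ts : Args Γ (MV.margs Z)} → DistinctVars ts → Pat (meta Z ts)
    p-lam  : ∀ {Γ σ τ} {t : Tm (σ ∷ Γ) τ} → Pat t → Pat (lam t)
    p-sp   : ∀ {Γ σ} {t : Tm Γ σ} → PatSp t → Pat t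
  data PatSp where
    ps-con : ∀ {Γ f} → PatSp {Γ} (con f)
    ps-fv  : ∀ {Γ x} → PatSp {Γ} (fv x)
    ps-bv  : ∀ {Γ σ} {p : Γ ∋ σ} → PatSp (bv p)
    ps-app : ∀ {Γ σ τ} {s : Tm Γ (σ ⇒ τ)} {t} → PatSp s → Pat t → PatSp (app s t)

  FunPat : ∀ {σ} → Tm [] σ → Set
  FunPat ℓ = PatSp ℓ × IsFunHd (proj₁ (spine ℓ))

  record Rule : Set where
    constructor mkRule
    field
      {rty} : Type
      lhs   : Tm [] rty
      rhs   : Tm [] rty

  WfRule : Rule → Set
  WfRule r = Closed (Rule.lhs r) × Closed (Rule.rhs r) × FunPat (Rule.lhs r)
           × (∀ Z → MetaPos Z (Rule.rhs r) → MetaPos Z (Rule.lhs r))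

  data Step (R : Rule → Set) : ∀ {σ} → Tm [] σ → Tm [] σ → Set where
    st-rule : ∀ {r} → R r → (δ : MSub) → TermSub δ →
              Step R (Rule.lhs r ⟪ δ ⟫) (Rule.rhs r ⟪ δ ⟫)
    st-beta : ∀ {σ τ} {u : Tm (σ ∷ []) τ} {v} → Step R (app (lam u) v) (u [0:= v ])
    st-appl : ∀ {σ τ} {s s' : Tm [] (σ ⇒ τ)} {t} → Step R s s' → Step R (app s t) (app s' t)
    st-appr : ∀ {σ τ} {s : Tm [] (σ ⇒ τ)} {t t'} → Step R t t' → Step R (app s t) (app s t')
    st-lam  : ∀ {σ τ} {u u' : Tm (σ ∷ []) τ} (x : ℕ) (eq : varTy x ≡ σ) →
              ¬ FVin x (lam u) → ¬ FVin x (lam u') →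
              Step R (u [0:= fvAt x eq ]) (u' [0:= fvAt x eq ]) → Step R (lam u) (lam u')

  Steps : (Rule → Set) → ∀ {σ} → Tm [] σ → Tm [] σ → Set
  Steps R = Star (Step R)

  data StepΣ (R : Rule → Set) : TmΣ [] → TmΣ [] → Set where
    stΣ : ∀ {σ} {s t : Tm [] σ} → Step R s t → StepΣ R (σ , s) (σ , t)

  FreshSyms : (Rule → Set) → Set
  FreshSyms R = ∀ σ → Σ (ℕ → Sym) λ g →
      (∀ {m n} → g m ≡ g n → m ≡ n) × (∀ n → symTy (g n) ≡ σ)
    × (∀ n r → R r → ¬ SymIn (g n) (Rule.lhs r) × ¬ SymIn (g n) (Rule.rhs r))

  NonTerminating : (Rule → Set) → Set
  NonTerminating R = Σ (ℕ → TmΣ []) λ s →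
    (∀ i → NoMeta (proj₂ (s i))) × (∀ i → StepΣ R (s i) (s (suc i)))

  _≻_ : Sort → Sort → Set
  a ≻ b = (a ⪰ b) × ¬ (b ⪰ a)

  _⪰+_ : Sort → Type → Set
  _≻-_ : Sort → Type → Set
  ι ⪰+ base κ = ι ⪰ κ
  ι ⪰+ (σ ⇒ τ) = (ι ≻- σ) × (ι ⪰+ τ)
  ι ≻- base κ = ι ≻ κ
  ι ≻- (σ ⇒ τ) = (ι ⪰+ σ) × (ι ≻- τ)

  -- i ∈ Acc(f) for f : σ  (1-based argument positions)
  AccSym : Type → ℕ → Set
  AccSym σ i = Σ Type λ ρ → lookup1 (argTys σ) i ≡ just ρ × (resSort σ ⪰+ ρ)

  AccVar : Type → ℕ → Set
  AccVar σ i = Σ Type λ ρ → lookup1 (argTys σ) i ≡ just ρ × (resSort σ ⪰ resSort ρ)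

  AccHd : ∀ {Γ} → TmΣ Γ → ℕ → Set
  AccHd (_ , con f) i = AccSym (symTy f) i
  AccHd (_ , fv x) i = AccVar (varTy x) i
  AccHd _ _ = ⊥

  -- "a ∉ FV(sᵢ)" (only a restriction when the head a is a variable)
  HdNotIn : ∀ {Γ τ} → TmΣ Γ → Tm Γ τ → Set
  HdNotIn (_ , fv x) a = ¬ FVin x a
  HdNotIn _ _ = ⊤

  infix 4 _⊵acc_
  data _⊵acc_ : ∀ {σ τ} → Tm [] σ → Tm [] τ → Set where
    acc-refl : ∀ {σ} {s : Tm [] σ} → s ⊵acc s
    acc-lam  : ∀ {σ τ ρ} {u : Tm (σ ∷ []) τ} {t : Tm [] ρ} (x : ℕ) (eq : varTy x ≡ σ) →
               ¬ FVin x (lam u) → (u [0:= fvAt x eq ]) ⊵acc t → lam u ⊵acc t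
    acc-arg  : ∀ {σ τ ρ} {s : Tm [] σ} {t : Tm [] τ} {h args} {a : Tm [] ρ} →
               spine s ≡ (h , args) → (i : ℕ) → AccHd h i →
               lookup1 args i ≡ just (ρ , a) → HdNotIn h a → a ⊵acc t → s ⊵acc t

  infix 4 _⊐_
  data _⊐_ : ∀ {ι κ} → Tm [] (base ι) → Tm [] (base κ) → Set where
    sq-a : ∀ {ι κ} {s : Tm [] (base ι)} {t : Tm [] (base κ)} →
           ¬ (_≡_ {A = TmΣ []} (base ι , s) (base κ , t)) → s ⊵acc t → s ⊐ t
    sq-b : ∀ {ι κ} {s : Tm [] (base ι)} {t : Tm [] (base κ)} →
           ¬ (_≡_ {A = TmΣ []} (base ι , s) (base κ , t)) →
           (Z : MV) (xs : Args [] (MV.margs Z)) → AllFV xs → s ⊵acc meta Z xs →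
           (ts : Args [] (MV.margs Z)) (ss : List (TmΣ [])) →
           spine t ≡ ((_ , meta Z ts) , ss) → s ⊐ t

  data _⊐Σ_ : TmΣ [] → TmΣ [] → Set where
    sqΣ : ∀ {ι κ} {s : Tm [] (base ι)} {t : Tm [] (base κ)} → s ⊐ t → (base ι , s) ⊐Σ (base κ , t)

  -- Dependency pairs  ℓ ⇛ p (A);  a condition Z:i is the pair (Z , i)
  -- (i 1-based)

  Conds : Set
  Conds = List (MV × ℕ)

  record DP : Set where
    constructor mkDP
    field
      {lty rty} : Type
      lhs   : Tm [] lty
      rhs   : Tm [] rty
      conds : Conds

  WfDP : DP → Set
  WfDP d = Closed (DP.lhs d) × FunPat (DP.lhs d)
         × Closed (DP.rhs d) × IsFunHd (proj₁ (spine (DP.rhs d)))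

  Conservative : DP → Set
  Conservative d = ∀ Z → MetaPos Z (DP.rhs d) → MetaPos Z (DP.lhs d)

  _∪P_ : (DP → Set) → (DP → Set) → DP → Set
  (P₁ ∪P P₂) d = P₁ d ⊎ P₂ d

  -- γ respects Z:i : γ(Z) = λx₁…xⱼ.t with i > j, or i ≤ j and xᵢ ∈ FV(t)
  RespIdx : ∀ {Γ σ} → ℕ → Tm Γ σ → Set
  RespIdx zero _ = ⊥
  RespIdx (suc zero) (lam t) = OccBV vz t
  RespIdx (suc (suc i)) (lam t) = RespIdx (suc i) t
  RespIdx (suc _) _ = ⊤

  Respects : Conds → MSub → Set
  Respects A γ = ∀ Z i → (Z , i) ∈ A → RespIdx i (γ Z)

  data BetaHead : ∀ {σ} → Tm [] σ → Tm [] σ → Set where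
    bh-here : ∀ {σ τ} {u : Tm (σ ∷ []) τ} {v} → BetaHead (app (lam u) v) (u [0:= v ])
    bh-app  : ∀ {σ τ} {s s' : Tm [] (σ ⇒ τ)} {w} → BetaHead s s' → BetaHead (app s w) (app s' w)

  data _⊵β[_]_ : ∀ {σ τ} → Tm [] σ → Conds → Tm [] τ → Set where
    b-refl : ∀ {σ A} {s : Tm [] σ} → s ⊵β[ A ] s
    b-lam  : ∀ {σ τ ρ A} {u : Tm (σ ∷ []) τ} {t : Tm [] ρ} (x : ℕ) (eq : varTy x ≡ σ) →
             ¬ FVin x (lam u) → (u [0:= fvAt x eq ]) ⊵β[ A ] t → lam u ⊵β[ A ] t
    b-arg  : ∀ {σ τ ρ A} {s : Tm [] σ} {t : Tm [] τ} {h args} {a : Tm [] ρ} →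
             spine s ≡ (h , args) → (ρ , a) ∈ args → a ⊵β[ A ] t → s ⊵β[ A ] t
    b-beta : ∀ {σ τ A} {s s' : Tm [] σ} {t : Tm [] τ} →
             BetaHead s s' → s' ⊵β[ A ] t → s ⊵β[ A ] t
    b-meta : ∀ {σ τ ρ A} {s : Tm [] σ} {t : Tm [] τ} {Z} {ts : Args [] (MV.margs Z)} {args}
               {a : Tm [] ρ} →
             spine s ≡ ((_ , meta Z ts) , args) → (i : ℕ) → (Z , i) ∈ A →
             lookup1 (argList ts) i ≡ just (ρ , a) → a ⊵β[ A ] t → s ⊵β[ A ] t

  BSet : Set₁
  BSet = ∀ {ι} → Tm [] (base ι) → Set

  Comp : BSet → (σ : Type) → Tm [] σ → Set
  Comp I (base ι) s = I s
  Comp I (σ ⇒ τ) s = ∀ t → Comp I σ t → Comp I τ (app s t)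

  SN : (Rule → Set) → ∀ {σ} → Tm [] σ → Set
  SN R s = Acc (λ t u → Step R u t) s

  data Neutral : ∀ {σ} → Tm [] σ → Set where
    ne-var  : ∀ {σ} {s : Tm [] σ} {x args} → spine s ≡ ((_ , fv x) , args) → Neutral s
    ne-beta : ∀ {σ ρ τ} {s : Tm [] σ} {u : Tm (ρ ∷ []) τ} {a args} →
              spine s ≡ ((_ , lam u) , a ∷ args) → Neutral s

  IsRC : (Rule → Set) → BSet → Set
  IsRC U I =
      (∀ {ι} (s : Tm [] (base ι)) → I s → NoMeta s)
    × (∀ {ι} (s : Tm [] (base ι)) → I s → SN U s)
    × (∀ {ι} (s t : Tm [] (base ι)) → I s → Step U s t → I t)
    × (∀ {ι} (s : Tm [] (base ι)) → NoMeta s → Neutral s → (∀ t → Step U s t → I t) → I s)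

  BT : Set
  BT = Σ Sort λ ι → Tm [] (base ι)

  data AppChain (P : ∀ {ρ} → Tm [] ρ → Set) {σ} (a : Tm [] σ) : ∀ {τ} → Tm [] τ → Set where
    ac-done : AppChain P a a
    ac-more : ∀ {ρ τ} {u : Tm [] (ρ ⇒ τ)} {v : Tm [] ρ} → AppChain P a u → P v → AppChain P a (app u v)

  data Leads (I : BSet) : BT → BT → Set where
    ld : ∀ {ι κ ρ} {s : Tm [] (base ι)} {t : Tm [] (base κ)} {f args} {a : Tm [] ρ} →
         spine s ≡ ((_ , con f) , args) → (i : ℕ) → AccSym (symTy f) i →
         lookup1 args i ≡ just (ρ , a) → AppChain (λ {ρ'} v → Comp I ρ' v) a t →
         Leads I (ι , s) (κ , t)

  data UStep (U : Rule → Set) (I : BSet) : BT → BT → Set where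
    us-red   : ∀ {ι} {s t : Tm [] (base ι)} → Step U s t → UStep U I (ι , s) (ι , t)
    us-leads : ∀ {p q} → Leads I p q → UStep U I p q

  -- C is (a set satisfying the defining characterisation of) C_U
  IsCU : (Rule → Set) → BSet → Set
  IsCU U C = IsRC U C ×
    (∀ {ι} (s : Tm [] (base ι)) → NoMeta s →
       C s ⇔ (Acc (λ q p → UStep U C p q) (ι , s)
              × (∀ (t : Tm [] (base ι)) f args → Steps U s t →
                   spine t ≡ ((_ , con f) , args) →
                   ∀ i ρ a → AccSym (symTy f) i → lookup1 args i ≡ just (ρ , a) → Comp C ρ a)))

  data IsBV {Γ σ} (x : Γ ∋ σ) : ∀ {τ} → Tm Γ τ → Set where
    isBV : IsBV x (bv x)

  data MissVar : ∀ {Γ σ τ} → Γ ∋ σ → Tm Γ τ → Set where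
    mi-at   : ∀ {Γ σ Z} {x : Γ ∋ σ} {ts : Args Γ (MV.margs Z)} →
              All (λ p → ¬ IsBV x (proj₂ p)) (argList ts) → MissVar x (meta Z ts)
    mi-arg  : ∀ {Γ σ Z} {x : Γ ∋ σ} {ts : Args Γ (MV.margs Z)} →
              Any (λ p → MissVar x (proj₂ p)) (argList ts) → MissVar x (meta Z ts)
    mi-appl : ∀ {Γ ρ σ τ} {x : Γ ∋ ρ} {s : Tm Γ (σ ⇒ τ)} {t} → MissVar x s → MissVar x (app s t)
    mi-appr : ∀ {Γ ρ σ τ} {x : Γ ∋ ρ} {s : Tm Γ (σ ⇒ τ)} {t} → MissVar x t → MissVar x (app s t)
    mi-lam  : ∀ {Γ ρ σ τ} {x : Γ ∋ ρ} {t : Tm (σ ∷ Γ) τ} → MissVar (vs x) t → MissVar x (lam t)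

  data LamMiss : ∀ {Γ τ} → Tm Γ τ → Set where
    lm-here : ∀ {Γ σ τ} {t : Tm (σ ∷ Γ) τ} → MissVar vz t → LamMiss (lam t)
    lm-lam  : ∀ {Γ σ τ} {t : Tm (σ ∷ Γ) τ} → LamMiss t → LamMiss (lam t)
    lm-appl : ∀ {Γ σ τ} {s : Tm Γ (σ ⇒ τ)} {t} → LamMiss s → LamMiss (app s t)
    lm-appr : ∀ {Γ σ τ} {s : Tm Γ (σ ⇒ τ)} {t} → LamMiss t → LamMiss (app s t)
    lm-arg  : ∀ {Γ Z} {ts : Args Γ (MV.margs Z)} →
              Any (λ p → LamMiss (proj₂ p)) (argList ts) → LamMiss (meta Z ts)

  data NotFEL {Γ σ} (ℓ : Tm Γ σ) : Set where
    nf-twice : (Z : MV) (p q : MetaPos Z ℓ) → p ≢ q → NotFEL ℓ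
    nf-lam   : LamMiss ℓ → NotFEL ℓ

  data ExtPair {ρ} (ℓ' r' : Tm [] ρ) : ∀ {σ} → Tm [] σ → Tm [] σ → Set where
    ep-done : ExtPair ℓ' r' ℓ' r'
    ep-more : ∀ {σ τ} {L Rt : Tm [] (σ ⇒ τ)} (n : ℕ) → ExtPair ℓ' r' L Rt →
              ¬ MetaPos (mvar n [] σ) L →
              ExtPair ℓ' r' (app L (meta (mvar n [] σ) []ₐ)) (app Rt (meta (mvar n [] σ) []ₐ))

  -- Form R ℓ γ s : there is an ℓ-formative reduction  s →*_R ℓγ
  data Form (R : Rule → Set) : ∀ {σ} → Tm [] σ → MSub → Tm [] σ → Set
  data FormSp (R : Rule → Set) : ∀ {σ} → Tm [] σ → MSub → Tm [] σ → Set
  data Form R where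
    f-nonfel : ∀ {σ} {ℓ s : Tm [] σ} {γ} → NotFEL ℓ → Steps R s (ℓ ⟪ γ ⟫) → Form R ℓ γ s
    f-meta   : ∀ {Z} {ts : Args [] (MV.margs Z)} {γ s} → AllFV ts →
               s ≡ (meta Z ts ⟪ γ ⟫) → Form R (meta Z ts) γ s
    f-head   : ∀ {σ} {ℓ s : Tm [] σ} {γ} → FormSp R ℓ γ s → Form R ℓ γ s
    f-lam    : ∀ {σ τ} {ℓ u : Tm (σ ∷ []) τ} {γ} (x : ℕ) (eq : varTy x ≡ σ) →
               ¬ FVin x (lam u) → ¬ FVin x (lam ℓ ⟪ γ ⟫) →
               Form R (ℓ [0:= fvAt x eq ]) γ (u [0:= fvAt x eq ]) → Form R (lam ℓ) γ (lam u)
    f-beta   : ∀ {σ} {ℓ s s' : Tm [] σ} {γ} → BetaHead s s' → Form R ℓ γ s' → Form R ℓ γ s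
    f-rule   : ∀ {σ} {ℓ s L Rt : Tm [] σ} {γ} {r : Rule} →
               ¬ IsMetaApp ℓ → R r → ExtPair (Rule.lhs r) (Rule.rhs r) L Rt →
               (δ : MSub) → TermSub δ → Form R L δ s → Form R ℓ γ (Rt ⟪ δ ⟫) → Form R ℓ γ s
  data FormSp R where
    fs-con : ∀ {f γ} → FormSp R (con f) γ (con f)
    fs-fv  : ∀ {x γ} → FormSp R (fv x) γ (fv x)
    fs-app : ∀ {σ τ} {ℓ₁ s₁ : Tm [] (σ ⇒ τ)} {ℓ₂ s₂ γ} →
             FormSp R ℓ₁ γ s₁ → Form R ℓ₂ γ s₂ → FormSp R (app ℓ₁ ℓ₂) γ (app s₁ s₂)

  data FormH (R : Rule → Set) {σ} (ℓ : Tm [] σ) (γ : MSub) : ∀ {τ} → Tm [] τ → Set where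
    formH : {s : Tm [] σ} → Form R ℓ γ s → FormH R ℓ γ s

  data RedΣ (R : Rule → Set) : TmΣ [] → TmΣ [] → Set where
    rΣ : ∀ {σ} {u w : Tm [] σ} → Steps R u w → RedΣ R (σ , u) (σ , w)

  data Link (R : Rule → Set) : ∀ {σ τ} → Tm [] σ → Tm [] τ → Set where
    link : ∀ {σ τ} {t : Tm [] σ} {s : Tm [] τ} {f : Sym} {us ws} →
           spine t ≡ ((_ , con f) , us) → spine s ≡ ((_ , con f) , ws) →
           Pointwise (RedΣ R) us ws → Link R t s

  record InfChain (P : DP → Set) (R : Rule → Set) : Set where
    field
      dps    : ℕ → DP
      γ      : ℕ → MSub
      inP    : ∀ i → P (dps i)
      γ-term : ∀ i → TermSub (γ i)
      γ-resp : ∀ i → Respects (DP.conds (dps i)) (γ i)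
      linked : ∀ i → Link R (DP.rhs (dps i) ⟪ γ i ⟫) (DP.lhs (dps (suc i)) ⟪ γ (suc i) ⟫)

  module _ {P : DP → Set} {R : Rule → Set} (ch : InfChain P R) where
    open InfChain ch

    UComputable : (Rule → Set) → BSet → Set
    UComputable U C =
        (∀ {σ} {s t : Tm [] σ} → Step R s t → Step U s t)
      × (∀ i (B : Conds) {τ} (v : Tm [] τ) (xs : List ℕ) →
           DP.rhs (dps i) ⊵β[ B ] v → Respects B (γ i) →
           Unique xs → (∀ x → FVin x v ⇔ x ∈ xs) →
           Comp C _ (closeAll xs v ⟪ γ i ⟫))

    FormativeChain : Set
    FormativeChain = ∀ i →
      FormH R (DP.lhs (dps (suc i))) (γ (suc i)) (DP.rhs (dps i) ⟪ γ i ⟫)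

  data Flag : Set where
    formative allChains : Flag

  FlagOK : Flag → ∀ {P R} → InfChain P R → Set
  FlagOK formative ch = FormativeChain ch
  FlagOK allChains ch = ⊤

  FiniteCU : (DP → Set) → (R U : Rule → Set) → BSet → Flag → Set
  FiniteCU P R U C fl = ¬ (Σ (InfChain P R) λ ch → UComputable ch U C × FlagOK fl ch)

  InfiniteDP : (DP → Set) → (Rule → Set) → Set
  InfiniteDP P R = NonTerminating R ⊎ InfChain (λ d → P d × Conservative d) R

  projν : (Sym → ℕ) → ∀ {τ} → Tm [] τ → Maybe (TmΣ [])
  projν ν t with spine t
  ... | ((_ , con f) , args) = lookup1 args (ν f)
  ... | _ = nothing

  data IsJust {A : Set} : Maybe A → Set where
    isJust : ∀ {a} → IsJust (just a)

  ProjFun : (Sym → ℕ) → (DP → Set) → Set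
  ProjFun ν P = ∀ d → P d → IsJust (projν ν (DP.lhs d)) × IsJust (projν ν (DP.rhs d))

  StrictlyDecr : (Sym → ℕ) → DP → Set
  StrictlyDecr ν d = Σ (TmΣ []) λ a → Σ (TmΣ []) λ b →
    projν ν (DP.lhs d) ≡ just a × projν ν (DP.rhs d) ≡ just b × a ⊐Σ b

  ProjEqual : (Sym → ℕ) → DP → Set
  ProjEqual ν d = Σ (TmΣ []) λ a →
    projν ν (DP.lhs d) ≡ just a × projν ν (DP.rhs d) ≡ just a

-- Along an infinite computable (P₁ ∪ P₂)-chain follow the ν-projections bᵢ = ν̄(pᵢ)γᵢ of the right-hand
-- sides.  They are computable, hence accessible for →_U ∪ ⇝_C, and the chain gives bᵢ →* ν̄(ℓᵢ₊₁)γᵢ₊₁.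
-- For a pair in P₂ the latter is bᵢ₊₁.  For a pair in P₁, ν̄(ℓ) ⊐ ν̄(p) survives instantiation: ν̄(p)γ
-- (in case (b), the computable instance of Z⟨x⃗⟩ obtained by sending the distinct variables x⃗ to the
-- respected arguments of Z⟨t⃗⟩) is reached from ν̄(ℓ)γ by ⇝-steps through accessible arguments, unless
-- the path passes a variable of smaller sort.  Well-foundedness of the sort order and of →_U ∪ ⇝_C on
-- computable terms then allows only finitely many P₁-pairs, so a tail of the chain is a computable
-- P₂-chain.  Completeness holds because every P₂-chain is a (P₁ ∪ P₂)-chain.

module Submission where

open import Defs
open import Data.Nat using (ℕ; zero; suc; _+_; _≟_)
open import Data.Nat.Properties using (+-suc)
open import Data.List using (List; []; _∷_; _++_; [_]; map)
open import Data.List.Properties using (map-++; ++-assoc; ++-identityʳ)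
open import Data.List.Relation.Unary.Any using (Any; here; there)
import Data.List.Relation.Unary.Any as Any
open import Data.List.Relation.Unary.All using (All; []; _∷_)
import Data.List.Relation.Unary.All as All
import Data.List.Relation.Unary.All.Properties as AllP
open import Data.List.Relation.Unary.AllPairs.Core using (AllPairs; []; _∷_)
open import Data.List.Relation.Binary.Pointwise using (Pointwise; []; _∷_)
open import Data.List.Membership.Propositional using (_∈_)
open import Data.List.Membership.Propositional.Properties using (∈-++⁻)
open import Data.Maybe using (Maybe; just)
import Data.Maybe as Maybe
open import Data.Maybe.Properties using (just-injective)
open import Data.Product using (Σ; _×_; _,_; proj₁; proj₂)
open import Data.Empty using (⊥; ⊥-elim)
open import Data.Unit using (⊤; tt)
open import Data.Sum using (_⊎_; inj₁; inj₂; [_,_]′; map₁)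
open import Relation.Nullary using (¬_; Dec; yes; no)
open import Relation.Nullary.Decidable using (¬¬-excluded-middle)
open import Relation.Nullary.Negation using (¬¬-map)
open import Relation.Binary.PropositionalEquality hiding ([_])
open import Relation.Binary.Structures using (IsPreorder)
open import Relation.Binary.Construct.Closure.ReflexiveTransitive using (Star; ε; _◅_; _◅◅_)
open import Induction.WellFounded using (Acc; acc)
open import Function.Bundles using (mk⇔; Equivalence)

Plus : ∀ {X : Set} → (X → X → Set) → X → X → Set
Plus _⟶_ x z = Σ _ λ y → x ⟶ y × Star _⟶_ y z

Star-Plus-trans : ∀ {X : Set} {_⟶_ : X → X → Set} {x y z} → Star _⟶_ x y → Plus _⟶_ y z → Plus _⟶_ x z
Star-Plus-trans ε p = p
Star-Plus-trans (s ◅ q) (_ , t , r) = _ , s , q ◅◅ (t ◅ r)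

InfinitelyOften : (ℕ → Set) → Set
InfinitelyOften P = ∀ i → ¬ ¬ (Σ ℕ λ k → P (suc (k + i)))

module _ (Sg : Sig) where
  open Sig Sg
  open Framework Sg

  RenEq : ∀ {Γ Δ} → Ren Γ Δ → Ren Γ Δ → Set
  RenEq ρ ρ' = ∀ {σ} (x : _ ∋ σ) → ρ x ≡ ρ' x

  SubEq : ∀ {Γ Δ} → Sub Γ Δ → Sub Γ Δ → Set
  SubEq θ θ' = ∀ {σ} (x : _ ∋ σ) → θ x ≡ θ' x

  liftR-ext : ∀ {Γ Δ σ} {ρ ρ' : Ren Γ Δ} → RenEq ρ ρ' → RenEq (liftR {σ = σ} ρ) (liftR ρ')
  liftR-ext e vz = refl
  liftR-ext e (vs x) = cong vs (e x)

  ren-ext : ∀ {Γ Δ τ} {ρ ρ' : Ren Γ Δ} → RenEq ρ ρ' → (t : Tm Γ τ) → ren ρ t ≡ ren ρ' t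
  renA-ext : ∀ {Γ Δ as} {ρ ρ' : Ren Γ Δ} → RenEq ρ ρ' → (t : Args Γ as) → renA ρ t ≡ renA ρ' t
  ren-ext e (fv x) = refl
  ren-ext e (bv x) = cong bv (e x)
  ren-ext e (con f) = refl
  ren-ext e (app s t) = cong₂ app (ren-ext e s) (ren-ext e t)
  ren-ext e (lam t) = cong lam (ren-ext (liftR-ext e) t)
  ren-ext e (meta Z ts) = cong (meta Z) (renA-ext e ts)
  renA-ext e []ₐ = refl
  renA-ext e (t ∷ₐ ts) = cong₂ _∷ₐ_ (ren-ext e t) (renA-ext e ts)

  liftS-ext : ∀ {Γ Δ σ} {θ θ' : Sub Γ Δ} → SubEq θ θ' → SubEq (liftS {σ = σ} θ) (liftS θ')
  liftS-ext e vz = refl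
  liftS-ext e (vs x) = cong (ren vs) (e x)

  sub-ext : ∀ {Γ Δ τ} {θ θ' : Sub Γ Δ} → SubEq θ θ' → (t : Tm Γ τ) → sub θ t ≡ sub θ' t
  subA-ext : ∀ {Γ Δ as} {θ θ' : Sub Γ Δ} → SubEq θ θ' → (t : Args Γ as) → subA θ t ≡ subA θ' t
  sub-ext e (fv x) = refl
  sub-ext e (bv x) = e x
  sub-ext e (con f) = refl
  sub-ext e (app s t) = cong₂ app (sub-ext e s) (sub-ext e t)
  sub-ext e (lam t) = cong lam (sub-ext (liftS-ext e) t)
  sub-ext e (meta Z ts) = cong (meta Z) (subA-ext e ts)
  subA-ext e []ₐ = refl
  subA-ext e (t ∷ₐ ts) = cong₂ _∷ₐ_ (sub-ext e t) (subA-ext e ts)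

  ren-ren : ∀ {Γ Δ Θ τ} (ρ : Ren Δ Θ) (ρ₀ : Ren Γ Δ) (t : Tm Γ τ) →
            ren ρ (ren ρ₀ t) ≡ ren (λ x → ρ (ρ₀ x)) t
  renA-ren : ∀ {Γ Δ Θ as} (ρ : Ren Δ Θ) (ρ₀ : Ren Γ Δ) (t : Args Γ as) →
             renA ρ (renA ρ₀ t) ≡ renA (λ x → ρ (ρ₀ x)) t
  ren-ren ρ ρ₀ (fv x) = refl
  ren-ren ρ ρ₀ (bv x) = refl
  ren-ren ρ ρ₀ (con f) = refl
  ren-ren ρ ρ₀ (app s t) = cong₂ app (ren-ren ρ ρ₀ s) (ren-ren ρ ρ₀ t)
  ren-ren ρ ρ₀ (lam t) =
    cong lam (trans (ren-ren (liftR ρ) (liftR ρ₀) t) (ren-ext (λ { vz → refl ; (vs x) → refl }) t))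
  ren-ren ρ ρ₀ (meta Z ts) = cong (meta Z) (renA-ren ρ ρ₀ ts)
  renA-ren ρ ρ₀ []ₐ = refl
  renA-ren ρ ρ₀ (t ∷ₐ ts) = cong₂ _∷ₐ_ (ren-ren ρ ρ₀ t) (renA-ren ρ ρ₀ ts)

  sub-ren : ∀ {Γ Δ Θ τ} (θ : Sub Δ Θ) (ρ₀ : Ren Γ Δ) (t : Tm Γ τ) →
            sub θ (ren ρ₀ t) ≡ sub (λ x → θ (ρ₀ x)) t
  subA-ren : ∀ {Γ Δ Θ as} (θ : Sub Δ Θ) (ρ₀ : Ren Γ Δ) (t : Args Γ as) →
             subA θ (renA ρ₀ t) ≡ subA (λ x → θ (ρ₀ x)) t
  sub-ren θ ρ₀ (fv x) = refl
  sub-ren θ ρ₀ (bv x) = refl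
  sub-ren θ ρ₀ (con f) = refl
  sub-ren θ ρ₀ (app s t) = cong₂ app (sub-ren θ ρ₀ s) (sub-ren θ ρ₀ t)
  sub-ren θ ρ₀ (lam t) =
    cong lam (trans (sub-ren (liftS θ) (liftR ρ₀) t) (sub-ext (λ { vz → refl ; (vs x) → refl }) t))
  sub-ren θ ρ₀ (meta Z ts) = cong (meta Z) (subA-ren θ ρ₀ ts)
  subA-ren θ ρ₀ []ₐ = refl
  subA-ren θ ρ₀ (t ∷ₐ ts) = cong₂ _∷ₐ_ (sub-ren θ ρ₀ t) (subA-ren θ ρ₀ ts)

  ren-sub : ∀ {Γ Δ Θ τ} (ρ : Ren Δ Θ) (θ : Sub Γ Δ) (t : Tm Γ τ) →
            ren ρ (sub θ t) ≡ sub (λ x → ren ρ (θ x)) t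
  renA-sub : ∀ {Γ Δ Θ as} (ρ : Ren Δ Θ) (θ : Sub Γ Δ) (t : Args Γ as) →
             renA ρ (subA θ t) ≡ subA (λ x → ren ρ (θ x)) t
  ren-sub ρ θ (fv x) = refl
  ren-sub ρ θ (bv x) = refl
  ren-sub ρ θ (con f) = refl
  ren-sub ρ θ (app s t) = cong₂ app (ren-sub ρ θ s) (ren-sub ρ θ t)
  ren-sub ρ θ (lam t) = cong lam (trans (ren-sub (liftR ρ) (liftS θ) t) (sub-ext lifted t))
    where
      lifted : SubEq (λ x → ren (liftR ρ) (liftS θ x)) (liftS (λ x → ren ρ (θ x)))
      lifted vz = refl
      lifted (vs x) = trans (ren-ren (liftR ρ) vs (θ x)) (sym (ren-ren vs ρ (θ x)))
  ren-sub ρ θ (meta Z ts) = cong (meta Z) (renA-sub ρ θ ts)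
  renA-sub ρ θ []ₐ = refl
  renA-sub ρ θ (t ∷ₐ ts) = cong₂ _∷ₐ_ (ren-sub ρ θ t) (renA-sub ρ θ ts)

  sub-sub : ∀ {Γ Δ Θ τ} (θ : Sub Δ Θ) (θ₀ : Sub Γ Δ) (t : Tm Γ τ) →
            sub θ (sub θ₀ t) ≡ sub (λ x → sub θ (θ₀ x)) t
  subA-sub : ∀ {Γ Δ Θ as} (θ : Sub Δ Θ) (θ₀ : Sub Γ Δ) (t : Args Γ as) →
             subA θ (subA θ₀ t) ≡ subA (λ x → sub θ (θ₀ x)) t
  sub-sub θ θ₀ (fv x) = refl
  sub-sub θ θ₀ (bv x) = refl
  sub-sub θ θ₀ (con f) = refl
  sub-sub θ θ₀ (app s t) = cong₂ app (sub-sub θ θ₀ s) (sub-sub θ θ₀ t)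
  sub-sub θ θ₀ (lam t) = cong lam (trans (sub-sub (liftS θ) (liftS θ₀) t) (sub-ext lifted t))
    where
      lifted : SubEq (λ x → sub (liftS θ) (liftS θ₀ x)) (liftS (λ x → sub θ (θ₀ x)))
      lifted vz = refl
      lifted (vs x) = trans (sub-ren (liftS θ) vs (θ₀ x)) (sym (ren-sub vs θ (θ₀ x)))
  sub-sub θ θ₀ (meta Z ts) = cong (meta Z) (subA-sub θ θ₀ ts)
  subA-sub θ θ₀ []ₐ = refl
  subA-sub θ θ₀ (t ∷ₐ ts) = cong₂ _∷ₐ_ (sub-sub θ θ₀ t) (subA-sub θ θ₀ ts)

  ren-id : ∀ {Γ τ} {ρ : Ren Γ Γ} → RenEq ρ (λ x → x) → (t : Tm Γ τ) → ren ρ t ≡ t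
  renA-id : ∀ {Γ as} {ρ : Ren Γ Γ} → RenEq ρ (λ x → x) → (t : Args Γ as) → renA ρ t ≡ t
  ren-id e (fv x) = refl
  ren-id e (bv x) = cong bv (e x)
  ren-id e (con f) = refl
  ren-id e (app s t) = cong₂ app (ren-id e s) (ren-id e t)
  ren-id e (lam t) = cong lam (ren-id (λ { vz → refl ; (vs x) → cong vs (e x) }) t)
  ren-id e (meta Z ts) = cong (meta Z) (renA-id e ts)
  renA-id e []ₐ = refl
  renA-id e (t ∷ₐ ts) = cong₂ _∷ₐ_ (ren-id e t) (renA-id e ts)

  ren-as-sub : ∀ {Γ Δ τ} (ρ : Ren Γ Δ) (t : Tm Γ τ) → ren ρ t ≡ sub (λ x → bv (ρ x)) t
  renA-as-sub : ∀ {Γ Δ as} (ρ : Ren Γ Δ) (t : Args Γ as) → renA ρ t ≡ subA (λ x → bv (ρ x)) t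
  ren-as-sub ρ (fv x) = refl
  ren-as-sub ρ (bv x) = refl
  ren-as-sub ρ (con f) = refl
  ren-as-sub ρ (app s t) = cong₂ app (ren-as-sub ρ s) (ren-as-sub ρ t)
  ren-as-sub ρ (lam t) =
    cong lam (trans (ren-as-sub (liftR ρ) t) (sub-ext (λ { vz → refl ; (vs x) → refl }) t))
  ren-as-sub ρ (meta Z ts) = cong (meta Z) (renA-as-sub ρ ts)
  renA-as-sub ρ []ₐ = refl
  renA-as-sub ρ (t ∷ₐ ts) = cong₂ _∷ₐ_ (ren-as-sub ρ t) (renA-as-sub ρ ts)

  sub-occ : ∀ {Γ Δ τ} (θ θ' : Sub Γ Δ) (t : Tm Γ τ) →
            (∀ {σ} (q : Γ ∋ σ) → OccBV q t → θ q ≡ θ' q) → sub θ t ≡ sub θ' t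
  subA-occ : ∀ {Γ Δ as} (θ θ' : Sub Γ Δ) (t : Args Γ as) →
             (∀ {σ} (q : Γ ∋ σ) → Any (λ p → OccBV q (proj₂ p)) (argList t) → θ q ≡ θ' q) →
             subA θ t ≡ subA θ' t
  sub-occ θ θ' (fv x) h = refl
  sub-occ θ θ' (bv x) h = h x ob-here
  sub-occ θ θ' (con f) h = refl
  sub-occ θ θ' (app s t) h =
    cong₂ app (sub-occ θ θ' s (λ q o → h q (ob-appl o))) (sub-occ θ θ' t (λ q o → h q (ob-appr o)))
  sub-occ θ θ' (lam t) h =
    cong lam (sub-occ (liftS θ) (liftS θ') t λ { vz o → refl ; (vs q) o → cong (ren vs) (h q (ob-lam o)) })
  sub-occ θ θ' (meta Z ts) h = cong (meta Z) (subA-occ θ θ' ts (λ q o → h q (ob-arg o)))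
  subA-occ θ θ' []ₐ h = refl
  subA-occ θ θ' (t ∷ₐ ts) h =
    cong₂ _∷ₐ_ (sub-occ θ θ' t (λ q o → h q (here o))) (subA-occ θ θ' ts (λ q o → h q (there o)))

  apps-sub : ∀ {Γ Δ as r} (θ : Sub Γ Δ) (t : Tm Γ (as ⇒* r)) (ss : Args Γ as) →
             sub θ (apps t ss) ≡ apps (sub θ t) (subA θ ss)
  apps-sub θ t []ₐ = refl
  apps-sub θ t (s ∷ₐ ss) = apps-sub θ (app t s) ss

  inst-ext : ∀ {Γ Δ} (as : List Type) {r} (t : Tm Δ (as ⇒* r)) {θ θ' : Sub Δ Γ} →
             SubEq θ θ' → (ss : Args Γ as) → inst as t θ ss ≡ inst as t θ' ss
  inst-ext [] t e []ₐ = sub-ext e t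
  inst-ext (a ∷ as) t e (s ∷ₐ ss) with lamView t
  ... | isLam u = inst-ext as u (λ { vz → refl ; (vs x) → e x }) ss
  ... | notLam = cong (λ z → apps z (s ∷ₐ ss)) (sub-ext e t)

  inst-sub : ∀ {Γ Δ Θ} (as : List Type) {r} (t : Tm Δ (as ⇒* r)) (θ : Sub Δ Γ) (ρ : Sub Γ Θ)
             (ss : Args Γ as) → sub ρ (inst as t θ ss) ≡ inst as t (λ x → sub ρ (θ x)) (subA ρ ss)
  inst-sub [] t θ ρ []ₐ = sub-sub ρ θ t
  inst-sub (a ∷ as) t θ ρ (s ∷ₐ ss) with lamView t
  ... | isLam u = trans (inst-sub as u (θ ▸ s) ρ ss)
                        (inst-ext as u (λ { vz → refl ; (vs x) → refl }) (subA ρ ss))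
  ... | notLam = trans (apps-sub ρ (sub θ t) (s ∷ₐ ss))
                       (cong (λ z → apps z (sub ρ s ∷ₐ subA ρ ss)) (sub-sub ρ θ t))

  inst-closed-sub : ∀ {Γ Θ} (as : List Type) {r} (t : Tm [] (as ⇒* r)) (ρ : Sub Γ Θ) (ss : Args Γ as) →
                    sub ρ (inst as t emptyS ss) ≡ inst as t emptyS (subA ρ ss)
  inst-closed-sub as t ρ ss = trans (inst-sub as t emptyS ρ ss) (inst-ext as t (λ ()) (subA ρ ss))

  msub-ren : ∀ {Γ Δ τ} (γ : MSub) (ρ : Ren Γ Δ) (t : Tm Γ τ) → (ren ρ t) ⟪ γ ⟫ ≡ ren ρ (t ⟪ γ ⟫)
  msubA-ren : ∀ {Γ Δ as} (γ : MSub) (ρ : Ren Γ Δ) (t : Args Γ as) →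
              (renA ρ t) ⟪ γ ⟫A ≡ renA ρ (t ⟪ γ ⟫A)
  msub-ren γ ρ (fv x) = refl
  msub-ren γ ρ (bv x) = refl
  msub-ren γ ρ (con f) = refl
  msub-ren γ ρ (app s t) = cong₂ app (msub-ren γ ρ s) (msub-ren γ ρ t)
  msub-ren γ ρ (lam t) = cong lam (msub-ren γ (liftR ρ) t)
  msub-ren γ ρ (meta Z ts) = sym (begin
      ren ρ (inst (MV.margs Z) (γ Z) emptyS (ts ⟪ γ ⟫A))
        ≡⟨ ren-as-sub ρ _ ⟩
      sub (λ x → bv (ρ x)) (inst (MV.margs Z) (γ Z) emptyS (ts ⟪ γ ⟫A))
        ≡⟨ inst-closed-sub (MV.margs Z) (γ Z) _ _ ⟩
      inst (MV.margs Z) (γ Z) emptyS (subA (λ x → bv (ρ x)) (ts ⟪ γ ⟫A))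
        ≡⟨ cong (inst (MV.margs Z) (γ Z) emptyS) (sym (renA-as-sub ρ _)) ⟩
      inst (MV.margs Z) (γ Z) emptyS (renA ρ (ts ⟪ γ ⟫A))
        ≡⟨ cong (inst (MV.margs Z) (γ Z) emptyS) (sym (msubA-ren γ ρ ts)) ⟩
      inst (MV.margs Z) (γ Z) emptyS ((renA ρ ts) ⟪ γ ⟫A) ∎)
    where open ≡-Reasoning
  msubA-ren γ ρ []ₐ = refl
  msubA-ren γ ρ (t ∷ₐ ts) = cong₂ _∷ₐ_ (msub-ren γ ρ t) (msubA-ren γ ρ ts)

  msub-sub : ∀ {Γ Δ τ} (γ : MSub) (θ : Sub Γ Δ) (t : Tm Γ τ) →
             (sub θ t) ⟪ γ ⟫ ≡ sub (λ x → (θ x) ⟪ γ ⟫) (t ⟪ γ ⟫)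
  msubA-sub : ∀ {Γ Δ as} (γ : MSub) (θ : Sub Γ Δ) (t : Args Γ as) →
              (subA θ t) ⟪ γ ⟫A ≡ subA (λ x → (θ x) ⟪ γ ⟫) (t ⟪ γ ⟫A)
  msub-sub γ θ (fv x) = refl
  msub-sub γ θ (bv x) = refl
  msub-sub γ θ (con f) = refl
  msub-sub γ θ (app s t) = cong₂ app (msub-sub γ θ s) (msub-sub γ θ t)
  msub-sub γ θ (lam t) = cong lam (trans (msub-sub γ (liftS θ) t)
                           (sub-ext (λ { vz → refl ; (vs x) → msub-ren γ vs (θ x) }) (t ⟪ γ ⟫)))
  msub-sub γ θ (meta Z ts) = sym (trans
      (inst-closed-sub (MV.margs Z) (γ Z) (λ x → (θ x) ⟪ γ ⟫) (ts ⟪ γ ⟫A))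
      (cong (inst (MV.margs Z) (γ Z) emptyS) (sym (msubA-sub γ θ ts))))
  msubA-sub γ θ []ₐ = refl
  msubA-sub γ θ (t ∷ₐ ts) = cong₂ _∷ₐ_ (msub-sub γ θ t) (msubA-sub γ θ ts)

  msub-nometa : ∀ {Γ τ} (γ : MSub) (t : Tm Γ τ) → NoMeta t → t ⟪ γ ⟫ ≡ t
  msubA-nometa : ∀ {Γ as} (γ : MSub) (t : Args Γ as) →
                 (∀ Z → ¬ Any (λ p → MetaPos Z (proj₂ p)) (argList t)) → t ⟪ γ ⟫A ≡ t
  msub-nometa γ (fv x) nm = refl
  msub-nometa γ (bv x) nm = refl
  msub-nometa γ (con f) nm = refl
  msub-nometa γ (app s t) nm = cong₂ app (msub-nometa γ s (λ Z p → nm Z (mp-appl p)))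
                                          (msub-nometa γ t (λ Z p → nm Z (mp-appr p)))
  msub-nometa γ (lam t) nm = cong lam (msub-nometa γ t (λ Z p → nm Z (mp-lam p)))
  msub-nometa γ (meta Z ts) nm = ⊥-elim (nm Z mp-here)
  msubA-nometa γ []ₐ nm = refl
  msubA-nometa γ (t ∷ₐ ts) nm = cong₂ _∷ₐ_ (msub-nometa γ t (λ Z p → nm Z (here p)))
                                           (msubA-nometa γ ts (λ Z p → nm Z (there p)))

  msub-β : ∀ {σ τ} (γ : MSub) (u : Tm (σ ∷ []) τ) (v : Tm [] σ) →
           (u [0:= v ]) ⟪ γ ⟫ ≡ (u ⟪ γ ⟫) [0:= v ⟪ γ ⟫ ]
  msub-β γ u v = trans (msub-sub γ (bv ▸ v) u) (sub-ext (λ { vz → refl ; (vs ()) }) (u ⟪ γ ⟫))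

  -- Z⟨s⃗⟩γ only depends on the arguments sⱼ at positions j that γ respects (Z:j).
  AgreeOnRespected : ∀ {Δ Γ σ as} → Tm Δ σ → Args Γ as → Args Γ as → Set
  AgreeOnRespected t ss ss' = ∀ j → lookup1 (argList ss) j ≡ lookup1 (argList ss') j ⊎ ¬ RespIdx j t

  notLam-respIdx : ∀ {Δ σ} (t : Tm Δ σ) → lamView t ≡ notLam → ∀ k → RespIdx (suc k) t
  notLam-respIdx (lam t) () k
  notLam-respIdx (fv x) e zero = tt
  notLam-respIdx (fv x) e (suc k) = tt
  notLam-respIdx (bv x) e zero = tt
  notLam-respIdx (bv x) e (suc k) = tt
  notLam-respIdx (con f) e zero = tt
  notLam-respIdx (con f) e (suc k) = tt
  notLam-respIdx (app s t) e zero = tt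
  notLam-respIdx (app s t) e (suc k) = tt
  notLam-respIdx (meta Z ts) e zero = tt
  notLam-respIdx (meta Z ts) e (suc k) = tt

  argList-injective : ∀ {as} (ss ss' : Args [] as) →
                      (∀ j → lookup1 (argList ss) (suc j) ≡ lookup1 (argList ss') (suc j)) → ss ≡ ss'
  argList-injective []ₐ []ₐ h = refl
  argList-injective (s ∷ₐ ss) (s' ∷ₐ ss') h with just-injective (h 0)
  ... | refl = cong (s ∷ₐ_) (argList-injective ss ss' (λ j → h (suc j)))

  inst-respected : ∀ {Δ} (as : List Type) {r} (t : Tm Δ (as ⇒* r)) (θ θ' : Sub Δ []) →
                   (∀ {σ} (q : Δ ∋ σ) → OccBV q t → θ q ≡ θ' q) →
                   (ss ss' : Args [] as) → AgreeOnRespected t ss ss' →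
                   inst as t θ ss ≡ inst as t θ' ss'
  inst-respected [] t θ θ' h []ₐ []ₐ c = sub-occ θ θ' t h
  inst-respected (a ∷ as) t θ θ' h (s ∷ₐ ss) (s' ∷ₐ ss') c with lamView t in eqv
  ... | isLam u = inst-respected as u (θ ▸ s) (θ' ▸ s') h' ss ss' (λ { zero → inj₁ refl ; (suc j) → c (suc (suc j)) })
    where
      h' : ∀ {σ} (q : _ ∋ σ) → OccBV q u → (θ ▸ s) q ≡ (θ' ▸ s') q
      h' vz o with c 1
      ... | inj₁ e with just-injective e
      ...   | refl = refl
      h' vz o | inj₂ n = ⊥-elim (n o)
      h' (vs q) o = h q (ob-lam o)
  ... | notLam = cong₂ apps (sub-occ θ θ' t h) (argList-injective (s ∷ₐ ss) (s' ∷ₐ ss') agree)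
    where
      agree : ∀ j → lookup1 (argList (s ∷ₐ ss)) (suc j) ≡ lookup1 (argList (s' ∷ₐ ss')) (suc j)
      agree j = [ (λ e → e) , (λ n → ⊥-elim (n (notLam-respIdx t eqv j))) ]′ (c (suc j))

  Valuation : Set
  Valuation = (x : ℕ) → Tm [] (varTy x)

  wk : ∀ {Γ σ} → Tm [] σ → Tm Γ σ
  wk = ren (λ ())

  fsub  : ∀ {Γ τ} → Valuation → Tm Γ τ → Tm Γ τ
  fsubA : ∀ {Γ as} → Valuation → Args Γ as → Args Γ as
  fsub ξ (fv x) = wk (ξ x)
  fsub ξ (bv x) = bv x
  fsub ξ (con f) = con f
  fsub ξ (app s t) = app (fsub ξ s) (fsub ξ t)
  fsub ξ (lam t) = lam (fsub ξ t)
  fsub ξ (meta Z ts) = meta Z (fsubA ξ ts)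
  fsubA ξ []ₐ = []ₐ
  fsubA ξ (t ∷ₐ ts) = fsub ξ t ∷ₐ fsubA ξ ts

  ren-wk : ∀ {Γ Δ σ} (ρ : Ren Γ Δ) (u : Tm [] σ) → ren ρ (wk u) ≡ wk u
  ren-wk ρ u = trans (ren-ren ρ (λ ()) u) (ren-ext (λ ()) u)

  sub-wk : ∀ {Γ Δ σ} (θ : Sub Γ Δ) (u : Tm [] σ) → sub θ (wk u) ≡ wk u
  sub-wk θ u = trans (sub-ren θ (λ ()) u) (trans (sub-ext (λ ()) u) (sym (ren-as-sub (λ ()) u)))

  wk-id : ∀ {σ} (u : Tm [] σ) → wk u ≡ u
  wk-id u = ren-id (λ ()) u

  fsub-ren : ∀ {Γ Δ τ} (ξ : Valuation) (ρ : Ren Γ Δ) (t : Tm Γ τ) → fsub ξ (ren ρ t) ≡ ren ρ (fsub ξ t)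
  fsubA-ren : ∀ {Γ Δ as} (ξ : Valuation) (ρ : Ren Γ Δ) (t : Args Γ as) →
              fsubA ξ (renA ρ t) ≡ renA ρ (fsubA ξ t)
  fsub-ren ξ ρ (fv x) = sym (ren-wk ρ (ξ x))
  fsub-ren ξ ρ (bv x) = refl
  fsub-ren ξ ρ (con f) = refl
  fsub-ren ξ ρ (app s t) = cong₂ app (fsub-ren ξ ρ s) (fsub-ren ξ ρ t)
  fsub-ren ξ ρ (lam t) = cong lam (fsub-ren ξ (liftR ρ) t)
  fsub-ren ξ ρ (meta Z ts) = cong (meta Z) (fsubA-ren ξ ρ ts)
  fsubA-ren ξ ρ []ₐ = refl
  fsubA-ren ξ ρ (t ∷ₐ ts) = cong₂ _∷ₐ_ (fsub-ren ξ ρ t) (fsubA-ren ξ ρ ts)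

  fsub-sub : ∀ {Γ Δ τ} (ξ : Valuation) (θ : Sub Γ Δ) (t : Tm Γ τ) →
             fsub ξ (sub θ t) ≡ sub (λ x → fsub ξ (θ x)) (fsub ξ t)
  fsubA-sub : ∀ {Γ Δ as} (ξ : Valuation) (θ : Sub Γ Δ) (t : Args Γ as) →
              fsubA ξ (subA θ t) ≡ subA (λ x → fsub ξ (θ x)) (fsubA ξ t)
  fsub-sub ξ θ (fv x) = sym (sub-wk _ (ξ x))
  fsub-sub ξ θ (bv x) = refl
  fsub-sub ξ θ (con f) = refl
  fsub-sub ξ θ (app s t) = cong₂ app (fsub-sub ξ θ s) (fsub-sub ξ θ t)
  fsub-sub ξ θ (lam t) = cong lam (trans (fsub-sub ξ (liftS θ) t)
                           (sub-ext (λ { vz → refl ; (vs x) → fsub-ren ξ vs (θ x) }) (fsub ξ t)))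
  fsub-sub ξ θ (meta Z ts) = cong (meta Z) (fsubA-sub ξ θ ts)
  fsubA-sub ξ θ []ₐ = refl
  fsubA-sub ξ θ (t ∷ₐ ts) = cong₂ _∷ₐ_ (fsub-sub ξ θ t) (fsubA-sub ξ θ ts)

  fsub-β : ∀ {σ τ} (ξ : Valuation) (u : Tm (σ ∷ []) τ) (v : Tm [] σ) →
           fsub ξ (u [0:= v ]) ≡ (fsub ξ u) [0:= fsub ξ v ]
  fsub-β ξ u v = trans (fsub-sub ξ (bv ▸ v) u) (sub-ext (λ { vz → refl ; (vs ()) }) (fsub ξ u))

  fsub-closed : ∀ {Γ τ} (ξ : Valuation) (t : Tm Γ τ) → (∀ x → ¬ FVin x t) → fsub ξ t ≡ t
  fsubA-closed : ∀ {Γ as} (ξ : Valuation) (t : Args Γ as) →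
                 (∀ x → ¬ Any (λ p → FVin x (proj₂ p)) (argList t)) → fsubA ξ t ≡ t
  fsub-closed ξ (fv x) c = ⊥-elim (c x fv-here)
  fsub-closed ξ (bv x) c = refl
  fsub-closed ξ (con f) c = refl
  fsub-closed ξ (app s t) c = cong₂ app (fsub-closed ξ s (λ x p → c x (fv-appl p)))
                                        (fsub-closed ξ t (λ x p → c x (fv-appr p)))
  fsub-closed ξ (lam t) c = cong lam (fsub-closed ξ t (λ x p → c x (fv-lam p)))
  fsub-closed ξ (meta Z ts) c = cong (meta Z) (fsubA-closed ξ ts (λ x p → c x (fv-arg p)))
  fsubA-closed ξ []ₐ c = refl
  fsubA-closed ξ (t ∷ₐ ts) c = cong₂ _∷ₐ_ (fsub-closed ξ t (λ x p → c x (here p)))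
                                          (fsubA-closed ξ ts (λ x p → c x (there p)))

  fsub-ext : ∀ {Γ τ} (ξ ξ' : Valuation) (t : Tm Γ τ) → (∀ y → FVin y t → ξ y ≡ ξ' y) → fsub ξ t ≡ fsub ξ' t
  fsubA-ext : ∀ {Γ as} (ξ ξ' : Valuation) (t : Args Γ as) →
              (∀ y → Any (λ p → FVin y (proj₂ p)) (argList t) → ξ y ≡ ξ' y) → fsubA ξ t ≡ fsubA ξ' t
  fsub-ext ξ ξ' (fv x) h = cong wk (h x fv-here)
  fsub-ext ξ ξ' (bv x) h = refl
  fsub-ext ξ ξ' (con f) h = refl
  fsub-ext ξ ξ' (app s t) h =
    cong₂ app (fsub-ext ξ ξ' s (λ y q → h y (fv-appl q))) (fsub-ext ξ ξ' t (λ y q → h y (fv-appr q)))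
  fsub-ext ξ ξ' (lam t) h = cong lam (fsub-ext ξ ξ' t (λ y q → h y (fv-lam q)))
  fsub-ext ξ ξ' (meta Z ts) h = cong (meta Z) (fsubA-ext ξ ξ' ts (λ y q → h y (fv-arg q)))
  fsubA-ext ξ ξ' []ₐ h = refl
  fsubA-ext ξ ξ' (t ∷ₐ ts) h =
    cong₂ _∷ₐ_ (fsub-ext ξ ξ' t (λ y q → h y (here q))) (fsubA-ext ξ ξ' ts (λ y q → h y (there q)))

  fsub-fvAt : ∀ {σ} (ξ : Valuation) (x : ℕ) (eq : varTy x ≡ σ) →
              fsub ξ (fvAt {[]} x eq) ≡ subst (Tm []) eq (ξ x)
  fsub-fvAt ξ x refl = wk-id (ξ x)

  module _ (F : ∀ {τ} → Tm [] τ → Tm [] τ)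
           (F-app : ∀ {σ τ} (s : Tm [] (σ ⇒ τ)) (t : Tm [] σ) → F (app s t) ≡ app (F s) (F t)) where
    FΣ : TmΣ [] → TmΣ []
    FΣ p = proj₁ p , F (proj₂ p)

    spine-hom : ∀ {τ} (t : Tm [] τ) → spine (F (proj₂ (proj₁ (spine t)))) ≡ (FΣ (proj₁ (spine t)) , []) →
                spine (F t) ≡ (FΣ (proj₁ (spine t)) , map FΣ (proj₂ (spine t)))
    spine-hom (fv x) g = g
    spine-hom (bv x) g = g
    spine-hom (con f) g = g
    spine-hom (lam t) g = g
    spine-hom (meta Z ts) g = g
    spine-hom (app s t) g rewrite F-app s t | spine-hom s g =
      cong (FΣ (proj₁ (spine s)) ,_) (sym (map-++ FΣ (proj₂ (spine s)) [ _ , t ]))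

    spine-hom-con : ∀ {τ} (t : Tm [] τ) {f args} → F (con f) ≡ con f → spine t ≡ ((_ , con f) , args) →
                    spine (F t) ≡ ((_ , con f) , map FΣ args)
    spine-hom-con t {f} {args} Fc e = begin
        spine (F t)
          ≡⟨ spine-hom t (subst (λ z → Good (proj₁ z)) (sym e) good) ⟩
        (FΣ (proj₁ (spine t)) , map FΣ (proj₂ (spine t)))
          ≡⟨ cong (λ z → FΣ (proj₁ z) , map FΣ (proj₂ z)) e ⟩
        ((_ , F (con f)) , map FΣ args)
          ≡⟨ cong (λ h → (_ , h) , map FΣ args) Fc ⟩
        ((_ , con f) , map FΣ args) ∎
      where
        open ≡-Reasoning
        Good : TmΣ [] → Set
        Good h = spine (F (proj₂ h)) ≡ (FΣ h , [])
        good : Good (_ , con f)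
        good rewrite Fc = refl

  lookup1-map : {A B : Set} (f : A → B) (xs : List A) (i : ℕ) →
                lookup1 (map f xs) i ≡ Maybe.map f (lookup1 xs i)
  lookup1-map f xs zero = refl
  lookup1-map f [] (suc i) = refl
  lookup1-map f (x ∷ xs) (suc zero) = refl
  lookup1-map f (x ∷ xs) (suc (suc i)) = lookup1-map f xs (suc i)

  lookup1-++ : {A : Set} (xs ys : List A) (i : ℕ) {a : A} →
               lookup1 xs i ≡ just a → lookup1 (xs ++ ys) i ≡ just a
  lookup1-++ xs ys zero ()
  lookup1-++ [] ys (suc i) ()
  lookup1-++ (x ∷ xs) ys (suc zero) e = e
  lookup1-++ (x ∷ xs) ys (suc (suc i)) e = lookup1-++ xs ys (suc i) e

  lookup1-∈ : {A : Set} (xs : List A) (i : ℕ) {a : A} → lookup1 xs i ≡ just a → a ∈ xs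
  lookup1-∈ xs zero ()
  lookup1-∈ [] (suc i) ()
  lookup1-∈ (x ∷ xs) (suc zero) refl = here refl
  lookup1-∈ (x ∷ xs) (suc (suc i)) e = there (lookup1-∈ xs (suc i) e)

  lookup1-pointwise : ∀ {A B : Set} {_∼_ : A → B → Set} {xs ys} (i : ℕ) {x} →
                      Pointwise _∼_ xs ys → lookup1 xs i ≡ just x →
                      Σ B λ y → lookup1 ys i ≡ just y × x ∼ y
  lookup1-pointwise zero p ()
  lookup1-pointwise (suc i) [] ()
  lookup1-pointwise (suc zero) (r ∷ p) refl = _ , refl , r
  lookup1-pointwise (suc (suc i)) (r ∷ p) e = lookup1-pointwise (suc i) p e

  data ArgOf {Γ} : ∀ {σ τ} → Tm Γ σ → Tm Γ τ → Set where
    arg-here : ∀ {σ τ} {s : Tm Γ (σ ⇒ τ)} {u} → ArgOf u (app s u)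
    arg-left : ∀ {σ τ ρ} {s : Tm Γ (σ ⇒ τ)} {u} {a : Tm Γ ρ} → ArgOf a s → ArgOf a (app s u)

  ∈-spine⇒ArgOf : ∀ {Γ τ ρ} (t : Tm Γ τ) {a : Tm Γ ρ} → (ρ , a) ∈ proj₂ (spine t) → ArgOf a t
  ∈-spine⇒ArgOf (fv x) ()
  ∈-spine⇒ArgOf (bv x) ()
  ∈-spine⇒ArgOf (con f) ()
  ∈-spine⇒ArgOf (lam t) ()
  ∈-spine⇒ArgOf (meta Z ts) ()
  ∈-spine⇒ArgOf (app s t) m with ∈-++⁻ (proj₂ (spine s)) m
  ... | inj₁ m' = arg-left (∈-spine⇒ArgOf s m')
  ... | inj₂ (here refl) = arg-here

  ∈-args⇒ArgOf : ∀ {Γ τ ρ} (t : Tm Γ τ) {h args} {a : Tm Γ ρ} →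
                 spine t ≡ (h , args) → (ρ , a) ∈ args → ArgOf a t
  ∈-args⇒ArgOf t e m = ∈-spine⇒ArgOf t (subst (λ z → _ ∈ proj₂ z) (sym e) m)

  ArgOf-FV : ∀ {Γ σ τ} {a : Tm Γ σ} {t : Tm Γ τ} {x} → ArgOf a t → FVin x a → FVin x t
  ArgOf-FV arg-here p = fv-appr p
  ArgOf-FV (arg-left q) p = fv-appl (ArgOf-FV q p)

  head-FV : ∀ {Γ τ} (s : Tm Γ τ) {y} → FVin y (proj₂ (proj₁ (spine s))) → FVin y s
  head-FV (fv x) p = p
  head-FV (app s t) p = fv-appl (head-FV s p)
  head-FV (lam s) p = p
  head-FV (meta Z ts) p = p

  fvHead-FV : ∀ {Γ τ} (s : Tm Γ τ) {y args} → spine s ≡ ((_ , fv y) , args) → FVin y s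
  fvHead-FV s {y} e = head-FV s (subst (λ z → FVin y (proj₂ (proj₁ z))) (sym e) fv-here)

  ⇒*-++ : ∀ (xs : List Type) {σ τ} → (xs ⇒* (σ ⇒ τ)) ≡ ((xs ++ [ σ ]) ⇒* τ)
  ⇒*-++ [] = refl
  ⇒*-++ (x ∷ xs) = cong (x ⇒_) (⇒*-++ xs)

  spine-headTy : ∀ {Γ τ} (t : Tm Γ τ) → proj₁ (proj₁ (spine t)) ≡ (map proj₁ (proj₂ (spine t)) ⇒* τ)
  spine-headTy (fv x) = refl
  spine-headTy (bv x) = refl
  spine-headTy (con f) = refl
  spine-headTy (lam t) = refl
  spine-headTy (meta Z ts) = refl
  spine-headTy (app s t) rewrite spine-headTy s | map-++ proj₁ (proj₂ (spine s)) [ _ , t ] =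
    ⇒*-++ (map proj₁ (proj₂ (spine s)))

  spine-headTy′ : ∀ {Γ τ σh} (t : Tm Γ τ) {h : Tm Γ σh} {args} → spine t ≡ ((σh , h) , args) →
                  σh ≡ (map proj₁ args ⇒* τ)
  spine-headTy′ {τ = τ} t e =
    trans (cong (λ z → proj₁ (proj₁ z)) (sym e)) (trans (spine-headTy t) (cong (λ z → map proj₁ (proj₂ z) ⇒* τ) e))

  resSort-⇒* : ∀ (xs : List Type) τ → resSort (xs ⇒* τ) ≡ resSort τ
  resSort-⇒* [] τ = refl
  resSort-⇒* (x ∷ xs) τ = resSort-⇒* xs τ

  argTys-⇒* : (xs : List Type) (τ : Type) → argTys (xs ⇒* τ) ≡ xs ++ argTys τ
  argTys-⇒* [] τ = refl
  argTys-⇒* (x ∷ xs) τ = cong (x ∷_) (argTys-⇒* xs τ)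

  spine-argTy : ∀ {σ ρ σh} (s : Tm [] σ) {hd : Tm [] σh} {args} {a : Tm [] ρ} (i : ℕ) →
                spine s ≡ ((σh , hd) , args) → lookup1 args i ≡ just (ρ , a) →
                lookup1 (argTys σh) i ≡ just ρ × resSort σh ≡ resSort σ
  spine-argTy {σ} {ρ} s {args = args} i e l rewrite spine-headTy′ s e =
      subst (λ L → lookup1 L i ≡ just ρ) (sym (argTys-⇒* (map proj₁ args) σ))
            (lookup1-++ (map proj₁ args) _ i (trans (lookup1-map proj₁ args i) (cong (Maybe.map proj₁) l)))
    , resSort-⇒* (map proj₁ args) σ

  spine-[] : ∀ {τ} (t : Tm [] τ) {σ} {h : Tm [] σ} → spine t ≡ ((σ , h) , []) →
             _≡_ {A = TmΣ []} (τ , t) (σ , h)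
  spine-[] (fv x) refl = refl
  spine-[] (bv x) refl = refl
  spine-[] (con f) refl = refl
  spine-[] (lam t) refl = refl
  spine-[] (meta Z ts) refl = refl
  spine-[] (app s t) e = ⊥-elim (snoc≢[] (proj₂ (spine s)) (cong proj₂ e))
    where
      snoc≢[] : ∀ (xs : List (TmΣ [])) {y} → xs ++ [ y ] ≢ []
      snoc≢[] [] ()
      snoc≢[] (x ∷ xs) ()

  isFunHd-con : ∀ {p : TmΣ []} → IsFunHd p → Σ Sym λ f → p ≡ (_ , con f)
  isFunHd-con isFun = _ , refl

  funHead-spine : ∀ {τ} (t : Tm [] τ) → IsFunHd (proj₁ (spine t)) →
                  Σ Sym λ f → spine t ≡ ((_ , con f) , proj₂ (spine t))
  funHead-spine t h with isFunHd-con h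
  ... | f , e = f , cong (_, proj₂ (spine t)) e

  γΣ : MSub → TmΣ [] → TmΣ []
  γΣ γ = FΣ (_⟪ γ ⟫) (λ _ _ → refl)

  spine-msub : ∀ {τ} (γ : MSub) (t : Tm [] τ) {f args} → spine t ≡ ((_ , con f) , args) →
               spine (t ⟪ γ ⟫) ≡ ((_ , con f) , map (γΣ γ) args)
  spine-msub γ t = spine-hom-con (_⟪ γ ⟫) (λ _ _ → refl) t refl

  projν-spine : (ν : Sym → ℕ) → ∀ {τ} (t : Tm [] τ) {f args} → spine t ≡ ((_ , con f) , args) →
                projν ν t ≡ lookup1 args (ν f)
  projν-spine ν t e rewrite e = refl

  patSp-arg : ∀ {τ} {t : Tm [] τ} → PatSp t → ∀ {ρ} {a : Tm [] ρ} → (ρ , a) ∈ proj₂ (spine t) → Pat a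
  patSp-arg (ps-app {s = s} ps p) m with ∈-++⁻ (proj₂ (spine s)) m
  ... | inj₁ m' = patSp-arg ps m'
  ... | inj₂ (here refl) = p

  fv-ren : ∀ {Γ Δ τ} (ρ : Ren Γ Δ) (t : Tm Γ τ) {y} → FVin y (ren ρ t) → FVin y t
  fvA-ren : ∀ {Γ Δ as} (ρ : Ren Γ Δ) (t : Args Γ as) {y} →
            Any (λ p → FVin y (proj₂ p)) (argList (renA ρ t)) → Any (λ p → FVin y (proj₂ p)) (argList t)
  fv-ren ρ (fv x) fv-here = fv-here
  fv-ren ρ (app s t) (fv-appl p) = fv-appl (fv-ren ρ s p)
  fv-ren ρ (app s t) (fv-appr p) = fv-appr (fv-ren ρ t p)
  fv-ren ρ (lam t) (fv-lam p) = fv-lam (fv-ren (liftR ρ) t p)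
  fv-ren ρ (meta Z ts) (fv-arg p) = fv-arg (fvA-ren ρ ts p)
  fvA-ren ρ (t ∷ₐ ts) (here p) = here (fv-ren ρ t p)
  fvA-ren ρ (t ∷ₐ ts) (there p) = there (fvA-ren ρ ts p)

  FVinSub : ∀ {Γ Δ} → Sub Γ Δ → ℕ → Set
  FVinSub {Γ} θ y = Σ Type λ σ → Σ (Γ ∋ σ) λ p → FVin y (θ p)

  fv-sub : ∀ {Γ Δ τ} (θ : Sub Γ Δ) (t : Tm Γ τ) {y} → FVin y (sub θ t) → FVin y t ⊎ FVinSub θ y
  fvA-sub : ∀ {Γ Δ as} (θ : Sub Γ Δ) (t : Args Γ as) {y} →
            Any (λ p → FVin y (proj₂ p)) (argList (subA θ t)) →
            Any (λ p → FVin y (proj₂ p)) (argList t) ⊎ FVinSub θ y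
  fv-sub θ (fv x) fv-here = inj₁ fv-here
  fv-sub θ (bv x) p = inj₂ (_ , x , p)
  fv-sub θ (app s t) (fv-appl p) = map₁ fv-appl (fv-sub θ s p)
  fv-sub θ (app s t) (fv-appr p) = map₁ fv-appr (fv-sub θ t p)
  fv-sub θ (lam t) (fv-lam p) with fv-sub (liftS θ) t p
  ... | inj₁ q = inj₁ (fv-lam q)
  ... | inj₂ (_ , vs x , q) = inj₂ (_ , x , fv-ren vs (θ x) q)
  fv-sub θ (meta Z ts) (fv-arg p) = map₁ fv-arg (fvA-sub θ ts p)
  fvA-sub θ (t ∷ₐ ts) (here p) = map₁ here (fv-sub θ t p)
  fvA-sub θ (t ∷ₐ ts) (there p) = map₁ there (fvA-sub θ ts p)

  fv-β : ∀ {σ τ} (u : Tm (σ ∷ []) τ) (v : Tm [] σ) {y} → FVin y (u [0:= v ]) → FVin y (lam u) ⊎ FVin y v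
  fv-β u v p with fv-sub (bv ▸ v) u p
  ... | inj₁ q = inj₁ (fv-lam q)
  ... | inj₂ (_ , vz , q) = inj₂ q

  fv-fvAt : ∀ {σ} (x : ℕ) (eq : varTy x ≡ σ) {y} → FVin y (fvAt {[]} x eq) → y ≡ x
  fv-fvAt x refl fv-here = refl

  IsVar : ∀ {Γ} → TmΣ Γ → Set
  IsVar p = Σ (ℕ ⊎ ℕ) λ i → varId (proj₂ p) ≡ just i

  VarsDiffer : ∀ {Γ} → TmΣ Γ → TmΣ Γ → Set
  VarsDiffer p q = varId (proj₂ p) ≢ varId (proj₂ q)

  DistinctVarArgs : ∀ {Γ as} → Args Γ as → Set
  DistinctVarArgs ts = All IsVar (argList ts) × AllPairs VarsDiffer (argList ts)

  MetaArgsDistinct : ∀ {Γ τ} → Tm Γ τ → Set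
  MetaArgsDistinct (fv x) = ⊤
  MetaArgsDistinct (bv x) = ⊤
  MetaArgsDistinct (con f) = ⊤
  MetaArgsDistinct (app s t) = MetaArgsDistinct s × MetaArgsDistinct t
  MetaArgsDistinct (lam t) = MetaArgsDistinct t
  MetaArgsDistinct (meta Z ts) = DistinctVarArgs ts

  distinctVars⇒ : ∀ {Γ} {xs : List (TmΣ Γ)} {ids} → Pointwise (λ p i → varId (proj₂ p) ≡ just i) xs ids →
                  AllPairs (λ a b → ¬ a ≡ b) ids → All IsVar xs × AllPairs VarsDiffer xs
  distinctVars⇒ [] [] = [] , []
  distinctVars⇒ (r ∷ pw) (a ∷ ap) =
    (_ , r) ∷ proj₁ (distinctVars⇒ pw ap) , differ r pw a ∷ proj₂ (distinctVars⇒ pw ap)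
    where
      differ : ∀ {x i xs ids} → varId (proj₂ x) ≡ just i → Pointwise (λ p i → varId (proj₂ p) ≡ just i) xs ids →
               All (λ b → ¬ i ≡ b) ids → All (VarsDiffer x) xs
      differ r [] [] = []
      differ r (r' ∷ pw) (n ∷ a) = (λ e → n (just-injective (trans (sym r) (trans e r')))) ∷ differ r pw a

  pat-MetaArgsDistinct : ∀ {Γ τ} {t : Tm Γ τ} → Pat t → MetaArgsDistinct t
  patSp-MetaArgsDistinct : ∀ {Γ τ} {t : Tm Γ τ} → PatSp t → MetaArgsDistinct t
  pat-MetaArgsDistinct (p-meta (ids , pw , u)) = distinctVars⇒ pw u
  pat-MetaArgsDistinct (p-lam p) = pat-MetaArgsDistinct p
  pat-MetaArgsDistinct (p-sp p) = patSp-MetaArgsDistinct p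
  patSp-MetaArgsDistinct ps-con = tt
  patSp-MetaArgsDistinct ps-fv = tt
  patSp-MetaArgsDistinct ps-bv = tt
  patSp-MetaArgsDistinct (ps-app p q) = patSp-MetaArgsDistinct p , pat-MetaArgsDistinct q

  ArgOf-MetaArgsDistinct : ∀ {Γ σ τ} {a : Tm Γ σ} {t : Tm Γ τ} → ArgOf a t → MetaArgsDistinct t → MetaArgsDistinct a
  ArgOf-MetaArgsDistinct arg-here (_ , m) = m
  ArgOf-MetaArgsDistinct (arg-left s) (m , _) = ArgOf-MetaArgsDistinct s m

  var-MetaArgsDistinct : ∀ {Γ τ} (v : Tm Γ τ) {i} → varId v ≡ just i → MetaArgsDistinct v
  var-MetaArgsDistinct (fv x) e = tt
  var-MetaArgsDistinct (bv x) e = tt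

  module _ {Γ Δ : List Type} (θ : Sub Γ Δ) where
    VarSub : Set
    VarSub = ∀ {σ} (p : Γ ∋ σ) → Σ (ℕ ⊎ ℕ) λ i → varId (θ p) ≡ just i
    InjectiveVarSub : Set
    InjectiveVarSub = ∀ {σ ρ} (p : Γ ∋ σ) (q : Γ ∋ ρ) →
                      varId (θ p) ≡ varId (θ q) → varId (bv {Γ} p) ≡ varId (bv {Γ} q)
    AvoidsFV : ∀ {τ} → Tm Γ τ → Set
    AvoidsFV t = ∀ {σ} (p : Γ ∋ σ) y → FVin y t → varId (θ p) ≢ just (inj₂ y)

  shiftId : Maybe (ℕ ⊎ ℕ) → Maybe (ℕ ⊎ ℕ)
  shiftId (just (inj₁ i)) = just (inj₁ (suc i))
  shiftId m = m

  varId-ren-vs : ∀ {Γ τ ρ} (v : Tm Γ τ) {i} → varId v ≡ just i → varId (ren (vs {τ = ρ}) v) ≡ shiftId (varId v)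
  varId-ren-vs (fv x) e = refl
  varId-ren-vs (bv x) e = refl

  shiftId-inj : ∀ (a b : Maybe (ℕ ⊎ ℕ)) {i j} → a ≡ just i → b ≡ just j → shiftId a ≡ shiftId b → a ≡ b
  shiftId-inj (just (inj₁ x)) (just (inj₁ .x)) e1 e2 refl = refl
  shiftId-inj (just (inj₂ y)) (just (inj₂ .y)) e1 e2 refl = refl
  shiftId-inj (just (inj₁ x)) (just (inj₂ y)) e1 e2 ()
  shiftId-inj (just (inj₂ y)) (just (inj₁ x)) e1 e2 ()

  module _ {Γ Δ : List Type} (θ : Sub Γ Δ) (isVar : VarSub θ) (inj : InjectiveVarSub θ) where
    sub-isVar : ∀ {τ} (v : Tm Γ τ) {i} → varId v ≡ just i → Σ (ℕ ⊎ ℕ) λ j → varId (sub θ v) ≡ just j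
    sub-isVar (fv x) e = _ , refl
    sub-isVar (bv p) e = isVar p

    sub-VarsDiffer : ∀ {ρ} {T : Tm Γ ρ} → ∀ {σ τ} (v : Tm Γ σ) (w : Tm Γ τ) {i j} →
                     varId v ≡ just i → varId w ≡ just j →
                     (∀ y → FVin y v → FVin y T) → (∀ y → FVin y w → FVin y T) → AvoidsFV θ T →
                     varId v ≢ varId w → varId (sub θ v) ≢ varId (sub θ w)
    sub-VarsDiffer (fv y) (fv z) e1 e2 f1 f2 avoid ne = ne
    sub-VarsDiffer (bv p) (bv q) e1 e2 f1 f2 avoid ne e = ne (inj p q e)
    sub-VarsDiffer (bv p) (fv z) e1 e2 f1 f2 avoid ne e = avoid p z (f2 z fv-here) e
    sub-VarsDiffer (fv y) (bv q) e1 e2 f1 f2 avoid ne e = avoid q y (f1 y fv-here) (sym e)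

  module _ {Γ Δ : List Type} (θ : Sub Γ Δ) (isVar : VarSub θ) (inj : InjectiveVarSub θ)
           {ρ : Type} {T : Tm Γ ρ} (avoid : AvoidsFV θ T) where
    subA-VarsDiffer : ∀ {σ as} (v : Tm Γ σ) {i} → varId v ≡ just i → (∀ y → FVin y v → FVin y T) →
                      (ts : Args Γ as) → All IsVar (argList ts) →
                      (∀ y → Any (λ p → FVin y (proj₂ p)) (argList ts) → FVin y T) →
                      All (VarsDiffer (_ , v)) (argList ts) → All (VarsDiffer (_ , sub θ v)) (argList (subA θ ts))
    subA-VarsDiffer v e fv1 []ₐ [] fk [] = []
    subA-VarsDiffer v e fv1 (t ∷ₐ ts) ((j , ej) ∷ iv) fk (d ∷ ds) =
        sub-VarsDiffer θ isVar inj v t e ej fv1 (λ y q → fk y (here q)) avoid d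
      ∷ subA-VarsDiffer v e fv1 ts iv (λ y q → fk y (there q)) ds

    subA-DistinctVarArgs : ∀ {as} (ts : Args Γ as) → DistinctVarArgs ts →
                           (∀ y → Any (λ p → FVin y (proj₂ p)) (argList ts) → FVin y T) → DistinctVarArgs (subA θ ts)
    subA-DistinctVarArgs []ₐ ([] , []) fk = [] , []
    subA-DistinctVarArgs (t ∷ₐ ts) ((i , e) ∷ iv , a ∷ ap) fk
      with subA-DistinctVarArgs ts (iv , ap) (λ y q → fk y (there q))
    ... | iv' , ap' = sub-isVar θ isVar inj t e ∷ iv'
                    , subA-VarsDiffer t e (λ y q → fk y (here q)) ts iv (λ y q → fk y (there q)) a ∷ ap'

  shiftId≢0 : ∀ (a : Maybe (ℕ ⊎ ℕ)) {i} → a ≡ just i → shiftId a ≢ just (inj₁ zero)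
  shiftId≢0 (just (inj₁ x)) e ()
  shiftId≢0 (just (inj₂ y)) e ()

  shiftId-inj₂ : ∀ (a : Maybe (ℕ ⊎ ℕ)) {i} y → a ≡ just i → shiftId a ≡ just (inj₂ y) → a ≡ just (inj₂ y)
  shiftId-inj₂ (just (inj₁ x)) y e ()
  shiftId-inj₂ (just (inj₂ z)) y e r = r

  module _ {Γ Δ : List Type} {σ : Type} (θ : Sub Γ Δ) (isVar : VarSub θ) where
    varId-liftS : ∀ {ρ} (p : Γ ∋ ρ) → varId (liftS {σ = σ} θ (vs p)) ≡ shiftId (varId (θ p))
    varId-liftS p = varId-ren-vs (θ p) (proj₂ (isVar p))

    varSub-lift : VarSub (liftS {σ = σ} θ)
    varSub-lift vz = _ , refl
    varSub-lift (vs p) with isVar p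
    ... | inj₁ i , e = _ , trans (varId-liftS p) (cong shiftId e)
    ... | inj₂ i , e = _ , trans (varId-liftS p) (cong shiftId e)

    injectiveVarSub-lift : InjectiveVarSub θ → InjectiveVarSub (liftS {σ = σ} θ)
    injectiveVarSub-lift inj vz vz e = refl
    injectiveVarSub-lift inj vz (vs q) e = ⊥-elim (shiftId≢0 _ (proj₂ (isVar q)) (trans (sym (varId-liftS q)) (sym e)))
    injectiveVarSub-lift inj (vs p) vz e = ⊥-elim (shiftId≢0 _ (proj₂ (isVar p)) (trans (sym (varId-liftS p)) e))
    injectiveVarSub-lift inj (vs p) (vs q) e =
      cong shiftId (inj p q (shiftId-inj _ _ (proj₂ (isVar p)) (proj₂ (isVar q))
                                          (trans (sym (varId-liftS p)) (trans e (varId-liftS q)))))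

    avoidsFV-lift : ∀ {τ} (t : Tm (σ ∷ Γ) τ) → AvoidsFV θ (lam t) → AvoidsFV (liftS θ) t
    avoidsFV-lift t avoid vz y q ()
    avoidsFV-lift t avoid (vs p) y q e =
      avoid p y (fv-lam q) (shiftId-inj₂ _ y (proj₂ (isVar p)) (trans (sym (varId-liftS p)) e))

  sub-MetaArgsDistinct : ∀ {Γ Δ τ} (θ : Sub Γ Δ) (t : Tm Γ τ) → VarSub θ → InjectiveVarSub θ → AvoidsFV θ t →
                         MetaArgsDistinct t → MetaArgsDistinct (sub θ t)
  sub-MetaArgsDistinct θ (fv x) isVar inj avoid m = tt
  sub-MetaArgsDistinct θ (bv p) isVar inj avoid m = var-MetaArgsDistinct (θ p) (proj₂ (isVar p))
  sub-MetaArgsDistinct θ (con f) isVar inj avoid m = tt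
  sub-MetaArgsDistinct θ (app s t) isVar inj avoid (ms , mt) =
      sub-MetaArgsDistinct θ s isVar inj (λ p y q → avoid p y (fv-appl q)) ms
    , sub-MetaArgsDistinct θ t isVar inj (λ p y q → avoid p y (fv-appr q)) mt
  sub-MetaArgsDistinct θ (lam t) isVar inj avoid m =
    sub-MetaArgsDistinct (liftS θ) t (varSub-lift θ isVar) (injectiveVarSub-lift θ isVar inj)
                         (avoidsFV-lift θ isVar t avoid) m
  sub-MetaArgsDistinct θ (meta Z ts) isVar inj avoid m =
    subA-DistinctVarArgs θ isVar inj avoid ts m (λ y q → fv-arg q)

  varId-fvAt : ∀ {Γ σ} (x : ℕ) (eq : varTy x ≡ σ) → varId (fvAt {Γ} x eq) ≡ just (inj₂ x)
  varId-fvAt x refl = refl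

  β-fresh-MetaArgsDistinct : ∀ {σ τ} (u : Tm (σ ∷ []) τ) (x : ℕ) (eq : varTy x ≡ σ) → ¬ FVin x (lam u) →
                             MetaArgsDistinct u → MetaArgsDistinct (u [0:= fvAt x eq ])
  β-fresh-MetaArgsDistinct {σ} u x eq nf m = sub-MetaArgsDistinct (bv ▸ fvAt x eq) u isVar inj avoid m
    where
      isVar : VarSub (bv ▸ fvAt x eq)
      isVar vz = _ , varId-fvAt x eq
      isVar (vs ())
      inj : InjectiveVarSub (bv ▸ fvAt x eq)
      inj vz vz e = refl
      inj vz (vs ()) e
      inj (vs ()) q e
      avoid : AvoidsFV (bv ▸ fvAt x eq) u
      avoid vz y q e with trans (sym (varId-fvAt x eq)) e
      ... | refl = nf (fv-lam q)
      avoid (vs ()) y q e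

  ⊵acc-MetaArgsDistinct : ∀ {σ τ} {s : Tm [] σ} {t : Tm [] τ} → s ⊵acc t → MetaArgsDistinct s → MetaArgsDistinct t
  ⊵acc-MetaArgsDistinct acc-refl m = m
  ⊵acc-MetaArgsDistinct (acc-lam {u = u} x eq nf p) m =
    ⊵acc-MetaArgsDistinct p (β-fresh-MetaArgsDistinct u x eq nf m)
  ⊵acc-MetaArgsDistinct (acc-arg {s = s} {args = args} e i _ l _ p) m =
    ⊵acc-MetaArgsDistinct p (ArgOf-MetaArgsDistinct (∈-args⇒ArgOf s e (lookup1-∈ args i l)) m)

  open IsPreorder ⪰-isPreorder using () renaming (refl to ⪰-refl; trans to ⪰-trans)

  ⪰-≻-trans : ∀ {a b c} → a ⪰ b → b ≻ c → a ≻ c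
  ⪰-≻-trans p (q , nq) = ⪰-trans p q , (λ r → nq (⪰-trans r p))

  ≻-⪰-trans : ∀ {a b c} → a ≻ b → b ⪰ c → a ≻ c
  ≻-⪰-trans (p , np) q = ⪰-trans p q , (λ r → np (⪰-trans q r))

  ⪰+⇒⪰ : ∀ {ι} σ → ι ⪰+ σ → ι ⪰ resSort σ
  ⪰+⇒⪰ (base κ) p = p
  ⪰+⇒⪰ (σ ⇒ τ) (_ , p) = ⪰+⇒⪰ τ p

  ≻-⇒≻ : ∀ {ι} σ → ι ≻- σ → ι ≻ resSort σ
  ≻-⇒≻ (base κ) p = p
  ≻-⇒≻ (σ ⇒ τ) (_ , p) = ≻-⇒≻ τ p

  ⪰-⪰+-trans : ∀ {ι κ} σ → ι ⪰ κ → κ ⪰+ σ → ι ⪰+ σ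
  ⪰-≻⁻-trans : ∀ {ι κ} σ → ι ⪰ κ → κ ≻- σ → ι ≻- σ
  ⪰-⪰+-trans (base μ) p q = ⪰-trans p q
  ⪰-⪰+-trans (σ ⇒ τ) p (q , r) = ⪰-≻⁻-trans σ p q , ⪰-⪰+-trans τ p r
  ⪰-≻⁻-trans (base μ) p q = ⪰-≻-trans p q
  ⪰-≻⁻-trans (σ ⇒ τ) p (q , r) = ⪰-⪰+-trans σ p q , ⪰-≻⁻-trans τ p r

  accSym-argTy : ∀ {σ ρ} (s : Tm [] σ) {f args} {a : Tm [] ρ} → spine s ≡ ((_ , con f) , args) →
                 (i : ℕ) → AccSym (symTy f) i → lookup1 args i ≡ just (ρ , a) → resSort σ ⪰+ ρ
  accSym-argTy s e i (ρ , l , q) l′ with spine-argTy s i e l′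
  ... | l″ , rs with trans (sym l) l″
  ... | refl = subst (_⪰+ ρ) rs q

  accVar-argTy : ∀ {σ ρ} (s : Tm [] σ) {y args} {a : Tm [] ρ} → spine s ≡ ((_ , fv y) , args) →
                 (i : ℕ) → AccVar (varTy y) i → lookup1 args i ≡ just (ρ , a) → resSort (varTy y) ⪰ resSort ρ
  accVar-argTy s e i (ρ , l , q) l′ with spine-argTy s i e l′
  ... | l″ , rs with trans (sym l) l″
  ... | refl = q

  ⊵acc-resSort : ∀ {σ τ} {s : Tm [] σ} {t : Tm [] τ} → s ⊵acc t → resSort σ ⪰ resSort τ
  ⊵acc-resSort acc-refl = ⪰-refl
  ⊵acc-resSort (acc-lam x eq _ p) = ⊵acc-resSort p
  ⊵acc-resSort (acc-arg {ρ = ρ} {s = s} {h = _ , con f} e i as l _ p) =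
    ⪰-trans (⪰+⇒⪰ ρ (accSym-argTy s e i as l)) (⊵acc-resSort p)
  ⊵acc-resSort (acc-arg {s = s} {h = _ , fv y} e i av l _ p) with spine-argTy s i e l
  ... | _ , rs = ⪰-trans (subst (_⪰ _) rs (accVar-argTy s e i av l)) (⊵acc-resSort p)

  neutral-notFunHd : ∀ {σ} {s : Tm [] σ} → Neutral s → IsFunHd (proj₁ (spine s)) → ⊥
  neutral-notFunHd (ne-var e) h rewrite e with h
  ... | ()
  neutral-notFunHd (ne-beta e) h rewrite e with h
  ... | ()

  lhs-funHd : ∀ {R : Rule → Set} → (∀ r → R r → WfRule r) → ∀ {r} → R r → (δ : MSub) →
              IsFunHd (proj₁ (spine (Rule.lhs r ⟪ δ ⟫)))
  lhs-funHd wf {r} Rr δ with funHead-spine (Rule.lhs r) (proj₂ (proj₁ (proj₂ (proj₂ (wf r Rr)))))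
  ... | f , e = subst (λ z → IsFunHd (proj₁ z)) (sym (spine-msub δ (Rule.lhs r) e)) isFun

  noMeta-app : ∀ {σ τ} {s : Tm [] (σ ⇒ τ)} {t} → NoMeta s → NoMeta t → NoMeta (app s t)
  noMeta-app a b Z (mp-appl p) = a Z p
  noMeta-app a b Z (mp-appr p) = b Z p

  neutral-app : ∀ {σ τ} {s : Tm [] (σ ⇒ τ)} {t} → Neutral s → Neutral (app s t)
  neutral-app {t = t} (ne-var e) = ne-var (cong (λ z → proj₁ z , proj₂ z ++ [ _ , t ]) e)
  neutral-app {t = t} (ne-beta e) = ne-beta (cong (λ z → proj₁ z , proj₂ z ++ [ _ , t ]) e)

  SN-appˡ : ∀ {R : Rule → Set} {σ τ} {s : Tm [] (σ ⇒ τ)} {t} → SN R (app s t) → SN R s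
  SN-appˡ (acc rs) = acc (λ st → SN-appˡ (rs (st-appl st)))

  neutral-fvAt : ∀ {σ} (x : ℕ) (eq : varTy x ≡ σ) → Neutral (fvAt {[]} x eq)
  neutral-fvAt x refl = ne-var refl

  noMeta-fvAt : ∀ {σ} (x : ℕ) (eq : varTy x ≡ σ) → NoMeta (fvAt {[]} x eq)
  noMeta-fvAt x refl Z ()

  someVar : ∀ σ → Σ ℕ λ x → varTy x ≡ σ
  someVar σ with varTy-inf σ
  ... | g , _ , e = g 0 , e 0

  module Candidates (U : Rule → Set) (wfU : ∀ r → U r → WfRule r) (C : BSet) (rc : IsRC U C) where

    CR2 : ∀ σ {s s' : Tm [] σ} → Comp C σ s → Step U s s' → Comp C σ s'
    CR2 (base ι) {s} {s'} c st = proj₁ (proj₂ (proj₂ rc)) s s' c st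
    CR2 (σ ⇒ τ) c st = λ t ct → CR2 τ (c t ct) (st-appl st)

    neutral-app-step : ∀ {σ τ} {s : Tm [] (σ ⇒ τ)} {t} {r : Tm [] τ} (w : Tm [] τ) → w ≡ app s t →
                       Neutral s → Step U w r →
                       (Σ _ λ s' → Step U s s' × r ≡ app s' t) ⊎ (Σ _ λ t' → Step U t t' × r ≡ app s t')
    neutral-app-step {t = t} w e n (st-rule Ur δ _) =
      ⊥-elim (neutral-notFunHd (neutral-app {t = t} n)
                               (subst (λ z → IsFunHd (proj₁ (spine z))) e (lhs-funHd wfU Ur δ)))
    neutral-app-step w refl (ne-var ()) st-beta
    neutral-app-step w refl (ne-beta ()) st-beta
    neutral-app-step w refl n (st-appl st) = inj₁ (_ , st , refl)
    neutral-app-step w refl n (st-appr st) = inj₂ (_ , st , refl)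

    fvAt-normal : ∀ {σ} (x : ℕ) (eq : varTy x ≡ σ) {r} → ¬ Step U (fvAt x eq) r
    fvAt-normal x refl {r} st = go refl st
      where
        go : ∀ {ρ} {w r' : Tm [] ρ} → _≡_ {A = TmΣ []} (ρ , w) (varTy x , fv x) → Step U w r' → ⊥
        go e (st-rule Ur δ _) =
          neutral-notFunHd {s = fv x} (ne-var refl)
                           (subst (λ z → IsFunHd (proj₁ (spine (proj₂ z)))) e (lhs-funHd wfU Ur δ))

    CR1 : ∀ σ {s : Tm [] σ} → Comp C σ s → SN U s × NoMeta s
    CR3 : ∀ σ {s : Tm [] σ} → NoMeta s → Neutral s → (∀ s' → Step U s s' → Comp C σ s') → Comp C σ s

    comp-fvAt : ∀ σ (x : ℕ) (eq : varTy x ≡ σ) → Comp C σ (fvAt x eq)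
    comp-fvAt σ x eq = CR3 σ (noMeta-fvAt x eq) (neutral-fvAt x eq) (λ s' st → ⊥-elim (fvAt-normal x eq st))

    CR1 (base ι) {s} c = proj₁ (proj₂ rc) s c , proj₁ rc s c
    CR1 (σ ⇒ τ) {s} c with someVar σ
    ... | x , eq with CR1 τ (c _ (comp-fvAt σ x eq))
    ... | sn , nm = SN-appˡ sn , (λ Z p → nm Z (mp-appl p))

    CR3 (base ι) {s} nm n h = proj₂ (proj₂ (proj₂ rc)) s nm n h
    CR3 (σ ⇒ τ) {s} nm n h t ct = go t ct (proj₁ (CR1 σ ct))
      where
        go : ∀ t → Comp C σ t → SN U t → Comp C τ (app s t)
        go t ct (acc rs) = CR3 τ (noMeta-app nm (proj₂ (CR1 σ ct))) (neutral-app n) λ r st →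
          [ (λ { (s' , st' , refl) → h s' st' t ct }) ,
            (λ { (t' , st' , refl) → go t' (CR2 σ ct st') (rs st') }) ]′ (neutral-app-step _ refl n st)

  -- Lexicographic induction: on a sort bound ι₀ along ≻, then on ⟶-accessibility of the walk's current point.
  module DescendingSequences {X : Set} (sort : X → Sort) (_⟶_ : X → X → Set) where

    module _ (b : ℕ → X) (Strict : ℕ → Set) (strict-io : InfinitelyOften Strict)
             (strict-acc : ∀ i → Strict i → Acc (λ y x → x ⟶ y) (b i))
             (strict-step : ∀ i → Strict (suc i) →
                            ¬ ¬ (sort (b i) ≻ sort (b (suc i))
                                 ⊎ (sort (b i) ⪰ sort (b (suc i)) × Plus _⟶_ (b i) (b (suc i)))))
             (weak-step : ∀ i → ¬ Strict (suc i) → sort (b i) ⪰ sort (b (suc i)) × Star _⟶_ (b i) (b (suc i))) where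

      NoStrictBelow : Sort → Set
      NoStrictBelow ι₀ = ∀ i → Strict i → ι₀ ⪰ sort (b i) → ⊥

      module _ (ι₀ : Sort) (ih : ∀ κ → ι₀ ≻ κ → NoStrictBelow κ) where
        NoStrictAhead : X → Set
        NoStrictAhead x = ∀ k i → Star _⟶_ x (b i) → ι₀ ⪰ sort (b i) → Strict (suc (k + i)) → ⊥

        step : ∀ x → (∀ {y} → x ⟶ y → NoStrictAhead y) → NoStrictAhead x
        step x rec k i path le str = ¬¬-excluded-middle λ
          { (no weak) → weakCase k str (weak-step i weak) weak
          ; (yes s) → strict-step i s λ
            { (inj₁ lt) → ih _ (⪰-≻-trans le lt) (suc i) s ⪰-refl
            ; (inj₂ (ge , pl)) → strict-io (suc i) λ
              { (k′ , s′) → continue (Star-Plus-trans path pl) (⪰-trans le ge) s′ } } }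
          where
            continue : ∀ {k′} → Plus _⟶_ x (b (suc i)) → ι₀ ⪰ sort (b (suc i)) → Strict (suc (k′ + suc i)) → ⊥
            continue (y , st , rest) = rec st _ (suc i) rest
            weakCase : ∀ k → Strict (suc (k + i)) → sort (b i) ⪰ sort (b (suc i)) × Star _⟶_ (b i) (b (suc i)) →
                       ¬ Strict (suc i) → ⊥
            weakCase zero str _ weak = weak str
            weakCase (suc k) str (ge , star) _ =
              step x rec k (suc i) (path ◅◅ star) (⪰-trans le ge) (subst (λ n → Strict (suc n)) (sym (+-suc k i)) str)

        walk : ∀ x → Acc (λ y x → x ⟶ y) x → NoStrictAhead x
        walk x (acc rs) = step x (λ st → walk _ (rs st))

      noStrictBelow : ∀ ι₀ → Acc (λ a b → (b ⪰ a) × ¬ (a ⪰ b)) ι₀ → NoStrictBelow ι₀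
      noStrictBelow ι₀ (acc rs) i s le = strict-io i λ { (k , s′) →
        walk ι₀ (λ κ lt → noStrictBelow κ (rs lt)) (b i) (strict-acc i s) k i ε le s′ }

      no-descending-sequence : ⊥
      no-descending-sequence = strict-io 0 λ { (k , s) → noStrictBelow _ (≻-wellFounded _) (suc (k + 0)) s ⪰-refl }

  module Reachability (U : Rule → Set) (wfU : ∀ r → U r → WfRule r) (C : BSet) (rc : IsRC U C) where
    open Candidates U wfU C rc

    data _⟶_ : TmΣ [] → TmΣ [] → Set where
      red  : ∀ {σ} {s t : Tm [] σ} → Step U s t → (σ , s) ⟶ (σ , t)
      lead : ∀ {ι κ} {s : Tm [] (base ι)} {t : Tm [] (base κ)} → Leads C (ι , s) (κ , t) →
             (base ι , s) ⟶ (base κ , t)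

    _⟶*_ : TmΣ [] → TmΣ [] → Set
    _⟶*_ = Star _⟶_

    _⟶⁺_ : TmΣ [] → TmΣ [] → Set
    _⟶⁺_ = Plus _⟶_

    steps⇒⟶* : ∀ {σ} {s t : Tm [] σ} → Steps U s t → (σ , s) ⟶* (σ , t)
    steps⇒⟶* ε = ε
    steps⇒⟶* (st ◅ sts) = red st ◅ steps⇒⟶* sts

    acc-⟶ : ∀ {x : BT} → Acc (λ q p → UStep U C p q) x → Acc (λ q p → p ⟶ q) (base (proj₁ x) , proj₂ x)
    acc-⟶ (acc rs) = acc λ { (red st) → acc-⟶ (rs (us-red st)) ; (lead l) → acc-⟶ (rs (us-leads l)) }

    data CompApp : ∀ {σ} → Tm [] σ → ∀ {κ} → Tm [] (base κ) → Set where
      done : ∀ {κ} {s : Tm [] (base κ)} → CompApp s s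
      more : ∀ {σ τ κ} {s : Tm [] (σ ⇒ τ)} {u : Tm [] σ} {h : Tm [] (base κ)} →
             Comp C σ u → CompApp (app s u) h → CompApp s h

    CompApp-base : ∀ {ι κ} {s : Tm [] (base ι)} {h : Tm [] (base κ)} → CompApp s h →
                   _≡_ {A = BT} (ι , s) (κ , h)
    CompApp-base done = refl

    CompApp⇒AppChain : ∀ {ρ σ κ} {a : Tm [] ρ} {s : Tm [] σ} {h : Tm [] (base κ)} →
                       AppChain (λ {ρ'} v → Comp C ρ' v) a s → CompApp s h → AppChain (λ {ρ'} v → Comp C ρ' v) a h
    CompApp⇒AppChain ac done = ac
    CompApp⇒AppChain ac (more c r) = CompApp⇒AppChain (ac-more ac c) r

    CompApp-step : ∀ {σ κ} {s s' : Tm [] σ} {h' : Tm [] (base κ)} → Step U s s' → CompApp s' h' →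
                   Σ (Tm [] (base κ)) λ h → CompApp s h × Step U h h'
    CompApp-step st done = _ , done , st
    CompApp-step st (more c r) with CompApp-step (st-appl st) r
    ... | h , r' , st' = h , more c r' , st'

    CompApp-spine : ∀ {σ κ} {s : Tm [] σ} {h : Tm [] (base κ)} → CompApp s h →
                    Σ (List (TmΣ [])) λ ex → spine h ≡ (proj₁ (spine s) , proj₂ (spine s) ++ ex)
    CompApp-spine {s = s} done = [] , cong (proj₁ (spine s) ,_) (sym (++-identityʳ _))
    CompApp-spine {s = s} (more {u = u} c r) with CompApp-spine r
    ... | ex , e = _ , trans e (cong (proj₁ (spine s) ,_) (++-assoc (proj₂ (spine s)) [ _ , u ] ex))

    saturate : ∀ σ (s : Tm [] σ) → Σ Sort λ κ → Σ (Tm [] (base κ)) λ h → CompApp s h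
    saturate (base κ) s = κ , s , done
    saturate (σ ⇒ τ) s with someVar σ
    ... | x , eq with saturate τ (app s (fvAt x eq))
    ... | κ , h , r = κ , h , more (comp-fvAt σ x eq) r

    module Instance (γ : MSub) (ξ : Valuation) (ξ-comp : ∀ x → Comp C (varTy x) (ξ x)) where

      T⟦_⟧ : ∀ {τ} → Tm [] τ → Tm [] τ
      T⟦ t ⟧ = (fsub ξ t) ⟪ γ ⟫

      spine-T : ∀ {σ} (s : Tm [] σ) {f args} → spine s ≡ ((_ , con f) , args) →
                spine T⟦ s ⟧ ≡ ((_ , con f) , map (λ p → proj₁ p , T⟦ proj₂ p ⟧) args)
      spine-T s = spine-hom-con T⟦_⟧ (λ _ _ → refl) s refl

      Reaches : ∀ {σ} → Tm [] σ → ∀ {κ} → Tm [] (base κ) → Set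
      Reaches s {κ} h' = Σ Sort λ κ' → Σ (Tm [] (base κ')) λ h → CompApp T⟦ s ⟧ h × (base κ' , h) ⟶* (base κ , h')

      ReachesStrictly : ∀ {σ} → Tm [] σ → ∀ {κ} → Tm [] (base κ) → Set
      ReachesStrictly s {κ} h' =
        Σ Sort λ κ' → Σ (Tm [] (base κ')) λ h → CompApp T⟦ s ⟧ h × (base κ' , h) ⟶⁺ (base κ , h')

      reaches-via-accArg : ∀ {σ ρ} (s : Tm [] σ) {f : Sym} {args} {a : Tm [] ρ} → spine s ≡ ((_ , con f) , args) →
                           (i : ℕ) → AccSym (symTy f) i → lookup1 args i ≡ just (ρ , a) →
                           ∀ {κ} {h' : Tm [] (base κ)} → Reaches a h' → ReachesStrictly s h'
      reaches-via-accArg {σ} s {f} {args} {a} e i as l (_ , _ , c₁ , path) with saturate σ T⟦ s ⟧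
      ... | κ' , h , ch with CompApp-spine ch
      ... | ex , esp = κ' , h , ch , _ , lead (ld {a = T⟦ a ⟧}
                 (trans esp (cong (λ z → proj₁ z , proj₂ z ++ ex) (spine-T s e))) i as
                 (lookup1-++ _ ex i (trans (lookup1-map _ args i) (cong (Maybe.map _) l)))
                 (CompApp⇒AppChain ac-done c₁)) , path

      comp-ξ : ∀ {σ} (x : ℕ) (eq : varTy x ≡ σ) → Comp C σ (subst (Tm []) eq (ξ x))
      comp-ξ x refl = ξ-comp x

      T-β : ∀ {σ τ} (u : Tm (σ ∷ []) τ) (x : ℕ) (eq : varTy x ≡ σ) →
            T⟦ u [0:= fvAt x eq ] ⟧ ≡ (fsub ξ u ⟪ γ ⟫) [0:= subst (Tm []) eq (ξ x) ]
      T-β u x eq = begin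
          (fsub ξ (u [0:= fvAt x eq ])) ⟪ γ ⟫
            ≡⟨ cong (_⟪ γ ⟫) (fsub-β ξ u (fvAt x eq)) ⟩
          ((fsub ξ u) [0:= fsub ξ (fvAt x eq) ]) ⟪ γ ⟫
            ≡⟨ msub-β γ (fsub ξ u) _ ⟩
          (fsub ξ u ⟪ γ ⟫) [0:= (fsub ξ (fvAt x eq)) ⟪ γ ⟫ ]
            ≡⟨ cong (λ z → (fsub ξ u ⟪ γ ⟫) [0:= z ]) (trans (cong (_⟪ γ ⟫) (fsub-fvAt ξ x eq))
                   (msub-nometa γ _ (proj₂ (CR1 _ (comp-ξ x eq))))) ⟩
          (fsub ξ u ⟪ γ ⟫) [0:= subst (Tm []) eq (ξ x) ] ∎
        where open ≡-Reasoning

      reaches-λ : ∀ {σ τ} (u : Tm (σ ∷ []) τ) (x : ℕ) (eq : varTy x ≡ σ) →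
                  ∀ {κ} {h' : Tm [] (base κ)} → Reaches (u [0:= fvAt x eq ]) h' → Reaches (lam u) h'
      reaches-λ u x eq (κ' , h₁ , c₁ , path)
        with CompApp-step (st-beta {u = fsub ξ u ⟪ γ ⟫} {v = subst (Tm []) eq (ξ x)})
                          (subst (λ z → CompApp z h₁) (T-β u x eq) c₁)
      ... | h , c , st = κ' , h , more (comp-ξ x eq) c , red st ◅ path

      -- ⇝ can follow every accessible argument below a function symbol; the path only breaks at an argument
      -- of a free variable, whose sort, and hence that of t, is below ι.
      ⊵acc-reaches : ∀ {ι σ τ} {s : Tm [] σ} {t : Tm [] τ} → s ⊵acc t → ι ⪰+ σ →
                     (∀ y → FVin y s → ι ≻ resSort (varTy y)) →
                     ι ≻ resSort τ ⊎ (∀ {κ} {h' : Tm [] (base κ)} → CompApp T⟦ t ⟧ h' → Reaches s h')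
      ⊵acc-reaches acc-refl _ _ = inj₂ (λ c → _ , _ , c , ε)
      ⊵acc-reaches {ι} {σ ⇒ _} (acc-lam {u = u} x eq nf p) (ι≻-σ , ι⪰+τ) fv≺ with ⊵acc-reaches p ι⪰+τ fv≺′
        where
          fv≺′ : ∀ y → FVin y (u [0:= fvAt x eq ]) → ι ≻ resSort (varTy y)
          fv≺′ y q = [ fv≺ y , (λ q′ → subst (λ z → ι ≻ resSort (varTy z)) (sym (fv-fvAt x eq q′))
                                        (subst (λ T → ι ≻ resSort T) (sym eq) (≻-⇒≻ σ ι≻-σ))) ]′
                     (fv-β u (fvAt x eq) q)
      ... | inj₁ d = inj₁ d
      ... | inj₂ P = inj₂ λ c → reaches-λ u x eq (P c)
      ⊵acc-reaches {σ = σ} (acc-arg {ρ = ρ} {s = s} {h = _ , con f} {args = args} e i as l _ p) ι⪰+σ fv≺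
        with ⊵acc-reaches p (⪰-⪰+-trans ρ (⪰+⇒⪰ σ ι⪰+σ) (accSym-argTy s e i as l))
                            (λ y r → fv≺ y (ArgOf-FV (∈-args⇒ArgOf s e (lookup1-∈ args i l)) r))
      ... | inj₁ d = inj₁ d
      ... | inj₂ P = inj₂ λ c → strict⇒reaches (reaches-via-accArg s e i as l (P c))
        where
          strict⇒reaches : ∀ {κ} {h' : Tm [] (base κ)} → ReachesStrictly s h' → Reaches s h'
          strict⇒reaches (κ' , h , c , _ , st , path) = κ' , h , c , st ◅ path
      ⊵acc-reaches (acc-arg {s = s} {h = _ , fv y} e i av l _ p) ι⪰+σ fv≺ =
        inj₁ (≻-⪰-trans (fv≺ y (fvHead-FV s e)) (⪰-trans (accVar-argTy s e i av l) (⊵acc-resSort p)))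

      ⊵acc-reachesStrictly : ∀ {ι τ} {a : Tm [] (base ι)} {t : Tm [] τ} → a ⊵acc t → Closed a →
                             _≢_ {A = TmΣ []} (base ι , a) (τ , t) →
                             ι ≻ resSort τ ⊎ (∀ {κ} {h : Tm [] (base κ)} → CompApp T⟦ t ⟧ h →
                                               (base ι , T⟦ a ⟧) ⟶⁺ (base κ , h))
      ⊵acc-reachesStrictly acc-refl cl ne = ⊥-elim (ne refl)
      ⊵acc-reachesStrictly {ι} {a = a} (acc-arg {h = _ , con f} {args = args} e i as l _ p) cl ne
        with ⊵acc-reaches p (accSym-argTy a e i as l)
                            (λ y r → ⊥-elim (cl y (ArgOf-FV (∈-args⇒ArgOf a e (lookup1-∈ args i l)) r)))
      ... | inj₁ d = inj₁ d
      ... | inj₂ P = inj₂ λ c → fromSelf (reaches-via-accArg a e i as l (P c))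
        where
          fromSelf : ∀ {κ} {h : Tm [] (base κ)} → ReachesStrictly a h → (base ι , T⟦ a ⟧) ⟶⁺ (base κ , h)
          fromSelf (κ' , h , ch , plus) with CompApp-base ch
          ... | refl = plus
      ⊵acc-reachesStrictly {a = a} (acc-arg {h = _ , fv y} e i as l _ p) cl ne = ⊥-elim (cl y (fvHead-FV a e))

  module Decrease (U : Rule → Set) (wfU : ∀ r → U r → WfRule r) (C : BSet) (rc : IsRC U C) where
    open Candidates U wfU C rc
    open Reachability U wfU C rc

    AllComp : ∀ {as} → Args [] as → Set
    AllComp ws = All (λ p → Comp C (proj₁ p) (proj₂ p)) (argList ws)

    AllComp-noMeta : ∀ {as} (ws : Args [] as) → AllComp ws → ∀ Z → ¬ Any (λ p → MetaPos Z (proj₂ p)) (argList ws)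
    AllComp-noMeta (w ∷ₐ ws) (c ∷ cs) Z (here q) = proj₂ (CR1 _ c) Z q
    AllComp-noMeta (w ∷ₐ ws) (c ∷ cs) Z (there q) = AllComp-noMeta ws cs Z q

    valuationFor : ∀ {as} (xs : Args [] as) → AllFV xs → Args [] as → Valuation
    valuationFor []ₐ [] []ₐ y = fv y
    valuationFor (t ∷ₐ xs) (isFV {x} ∷ af) (w ∷ₐ ws) y with x ≟ y
    ... | yes refl = w
    ... | no _ = valuationFor xs af ws y

    valuationFor-comp : ∀ {as} (xs : Args [] as) (af : AllFV xs) (ws : Args [] as) → AllComp ws →
                        ∀ y → Comp C (varTy y) (valuationFor xs af ws y)
    valuationFor-comp []ₐ [] []ₐ [] y = comp-fvAt (varTy y) y refl
    valuationFor-comp (t ∷ₐ xs) (isFV {x} ∷ af) (w ∷ₐ ws) (c ∷ cs) y with x ≟ y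
    ... | yes refl = c
    ... | no _ = valuationFor-comp xs af ws cs y

    VarsDiffer-FV : ∀ {x y} {L : List (TmΣ [])} → All (VarsDiffer (varTy x , fv x)) L → All IsFV L →
                    Any (λ p → FVin y (proj₂ p)) L → x ≢ y
    VarsDiffer-FV (d ∷ ds) (isFV ∷ af) (here fv-here) refl = d refl
    VarsDiffer-FV (d ∷ ds) (_ ∷ af) (there q) = VarsDiffer-FV ds af q

    fsubA-valuationFor : ∀ {as} (xs : Args [] as) (af : AllFV xs) (ws : Args [] as) → DistinctVarArgs xs →
                         fsubA (valuationFor xs af ws) xs ≡ ws
    fsubA-valuationFor []ₐ [] []ₐ _ = refl
    fsubA-valuationFor (t ∷ₐ xs) (isFV {x} ∷ af) (w ∷ₐ ws) (_ ∷ iv , d ∷ dp) = cong₂ _∷ₐ_ head tail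
      where
        head : wk (valuationFor (fv x ∷ₐ xs) (isFV ∷ af) (w ∷ₐ ws) x) ≡ w
        head with x ≟ x
        ... | yes refl = wk-id w
        ... | no x≢x = ⊥-elim (x≢x refl)
        agree : ∀ y → Any (λ p → FVin y (proj₂ p)) (argList xs) →
                valuationFor (fv x ∷ₐ xs) (isFV ∷ af) (w ∷ₐ ws) y ≡ valuationFor xs af ws y
        agree y q with x ≟ y
        ... | yes refl = ⊥-elim (VarsDiffer-FV d af q refl)
        ... | no _ = refl
        tail : fsubA (valuationFor (fv x ∷ₐ xs) (isFV ∷ af) (w ∷ₐ ws)) xs ≡ ws
        tail = trans (fsubA-ext _ (valuationFor xs af ws) xs agree) (fsubA-valuationFor xs af ws (iv , dp))

    -- R j (in use: γ Z respects position j) need not be decidable; by excluded middle those positions get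
    -- uⱼγ and the others a variable.
    ¬¬-compArgs : (γ : MSub) (R : ℕ → Set) → ∀ {as} (us : Args [] as) →
                  (∀ j {ρ} {u : Tm [] ρ} → lookup1 (argList us) j ≡ just (ρ , u) → R j → Comp C ρ (u ⟪ γ ⟫)) →
                  ¬ ¬ (Σ (Args [] as) λ ws → AllComp ws ×
                         ∀ j → lookup1 (argList ws) j ≡ lookup1 (argList (us ⟪ γ ⟫A)) j ⊎ ¬ R j)
    ¬¬-compArgs γ R []ₐ h k = k ([]ₐ , [] , λ j → inj₁ refl)
    ¬¬-compArgs γ R {ρ ∷ _} (u ∷ₐ us) h k = ¬¬-excluded-middle λ R₁? →
      ¬¬-compArgs γ (λ j → R (suc j)) us (λ { zero () ; (suc j) l r → h (suc (suc j)) l r }) λ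
        { (ws , cws , agree) →
            k ( choose R₁? ∷ₐ ws , comp-choose R₁? ∷ cws
              , λ { zero → inj₁ refl ; (suc zero) → agree-choose R₁? ; (suc (suc j)) → agree (suc j) }) }
      where
        choose : Dec (R 1) → Tm [] ρ
        choose (yes _) = u ⟪ γ ⟫
        choose (no _) = fvAt (proj₁ (someVar ρ)) (proj₂ (someVar ρ))
        comp-choose : (d : Dec (R 1)) → Comp C ρ (choose d)
        comp-choose (yes r) = h 1 refl r
        comp-choose (no _) = comp-fvAt ρ _ _
        agree-choose : (d : Dec (R 1)) → just (_,_ {B = Tm []} ρ (choose d)) ≡ just (ρ , u ⟪ γ ⟫) ⊎ ¬ R 1
        agree-choose (yes _) = inj₁ refl
        agree-choose (no ¬r) = inj₂ ¬r

    CompApp-spineArgs : ∀ (γ : MSub) {τ κ} (t : Tm [] τ) {H : Tm [] (base κ)} → CompApp (t ⟪ γ ⟫) H →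
                        All (λ p → Comp C (proj₁ p) (proj₂ p ⟪ γ ⟫)) (proj₂ (spine t)) →
                        CompApp (proj₂ (proj₁ (spine t)) ⟪ γ ⟫) H
    CompApp-spineArgs γ (fv x) c a = c
    CompApp-spineArgs γ (bv x) c a = c
    CompApp-spineArgs γ (con f) c a = c
    CompApp-spineArgs γ (lam t) c a = c
    CompApp-spineArgs γ (meta Z ts) c a = c
    CompApp-spineArgs γ (app s u) c a with AllP.++⁻ (proj₂ (spine s)) a
    ... | as , (cu ∷ []) = CompApp-spineArgs γ s (more cu c) as

    closedMetaApp≡ : ∀ {ι κ} (Z : MV) (xs : Args [] (MV.margs Z)) → AllFV xs → Closed (meta Z xs) →
                     (ts : Args [] (MV.margs Z)) (ss : List (TmΣ [])) (b : Tm [] (base κ)) →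
                     spine b ≡ ((_ , meta Z ts) , ss) → MV.mres Z ≡ base ι →
                     _≡_ {A = TmΣ []} (MV.mres Z , meta Z xs) (base κ , b)
    closedMetaApp≡ Z (x ∷ₐ xs) (isFV ∷ _) cl ts ss b e m = ⊥-elim (cl _ (fv-arg (here fv-here)))
    closedMetaApp≡ Z []ₐ [] cl []ₐ [] b e m = sym (spine-[] b e)
    closedMetaApp≡ Z []ₐ [] cl []ₐ (_ ∷ ss) b e m with trans (sym m) (spine-headTy′ b e)
    ... | ()

    Decreases : ∀ {ι κ} → Tm [] (base ι) → Tm [] (base κ) → MSub → Set
    Decreases {ι} {κ} a b γ = ι ≻ κ ⊎ (ι ⪰ κ × (base ι , a ⟪ γ ⟫) ⟶⁺ (base κ , b ⟪ γ ⟫))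

    ComputableBelow : ∀ {σ} → Tm [] σ → MSub → Set
    ComputableBelow b γ = ∀ B {τ} (v : Tm [] τ) → b ⊵β[ B ] v → Respects B γ → Closed v → Comp C τ (v ⟪ γ ⟫)

    module _ (γ : MSub) (ξ : Valuation) (ξ-comp : ∀ x → Comp C (varTy x) (ξ x)) where
      open Instance γ ξ ξ-comp

      ⊵acc-decreases : ∀ {ι κ τ} {a : Tm [] (base ι)} {t : Tm [] τ} (b : Tm [] (base κ)) →
                       a ⊵acc t → Closed a → _≢_ {A = TmΣ []} (base ι , a) (τ , t) → resSort τ ≡ κ →
                       CompApp T⟦ t ⟧ (b ⟪ γ ⟫) → Decreases a b γ
      ⊵acc-decreases {ι} {a = a} b d ca ne eq c with ⊵acc-reachesStrictly d ca ne
      ... | inj₁ lt = inj₁ (subst (ι ≻_) eq lt)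
      ... | inj₂ P = inj₂ ( subst (ι ⪰_) eq (⊵acc-resSort d)
                          , subst (λ z → (base ι , z ⟪ γ ⟫) ⟶⁺ _) (fsub-closed ξ a ca) (P c))

    fv-comp : ∀ x → Comp C (varTy x) (fv x)
    fv-comp x = comp-fvAt (varTy x) x refl

    ⊐-decreases : ∀ {ι κ} {a : Tm [] (base ι)} {b : Tm [] (base κ)} → a ⊐ b → Closed a → Pat a → Closed b →
                  (γ : MSub) → ComputableBelow b γ → ¬ ¬ Decreases a b γ
    ⊐-decreases {b = b} (sq-a ne d) ca pa cb γ comp k =
      k (⊵acc-decreases γ fv fv-comp b d ca ne refl
           (subst (λ z → CompApp (z ⟪ γ ⟫) (b ⟪ γ ⟫)) (sym (fsub-closed fv b cb)) done))
    ⊐-decreases {ι} {κ} {a} {b} (sq-b ne Z xs af d ts ss e) ca pa cb γ comp k =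
      ¬¬-compArgs γ (λ j → RespIdx j (γ Z)) ts respected-comp λ { (ws , cws , agree) →
        k (⊵acc-decreases γ (valuationFor xs af ws) (valuationFor-comp xs af ws cws) b d ca notSelf mres≡κ
             (subst (λ z → CompApp z (b ⟪ γ ⟫)) (sym (instance≡target ws cws agree)) target)) }
      where
        mres≡κ : resSort (MV.mres Z) ≡ κ
        mres≡κ = trans (cong resSort (spine-headTy′ b e)) (resSort-⇒* (map proj₁ ss) (base κ))

        respected-comp : ∀ j {ρ} {t : Tm [] ρ} → lookup1 (argList ts) j ≡ just (ρ , t) → RespIdx j (γ Z) →
                         Comp C ρ (t ⟪ γ ⟫)
        respected-comp j {ρ} {t} l r =
          comp [ (Z , j) ] t (b-meta e j (here refl) l b-refl) (λ { Z' i' (here refl) → r ; Z' i' (there ()) })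
            (λ y q → cb y (head-FV b (subst (λ z → FVin y (proj₂ (proj₁ z))) (sym e)
                                            (fv-arg (Any.map (λ { refl → q }) (lookup1-∈ _ j l))))))

        target : CompApp (meta Z ts ⟪ γ ⟫) (b ⟪ γ ⟫)
        target = subst (λ z → CompApp (proj₂ (proj₁ z) ⟪ γ ⟫) (b ⟪ γ ⟫)) e (CompApp-spineArgs γ b done
                   (subst (λ z → All (λ p → Comp C (proj₁ p) (proj₂ p ⟪ γ ⟫)) (proj₂ z)) (sym e)
                     (All.tabulate (λ {p} m → comp [] (proj₂ p) (b-arg e m b-refl) (λ _ _ ())
                                                (λ y q → cb y (ArgOf-FV (∈-args⇒ArgOf b e m) q))))))

        notSelf : _≢_ {A = TmΣ []} (base ι , a) (MV.mres Z , meta Z xs)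
        notSelf eq = ne (trans eq (closedMetaApp≡ Z xs af (subst (λ z → Closed (proj₂ z)) eq ca) ts ss b e
                                                  (sym (cong proj₁ eq))))

        instance≡target : (ws : Args [] (MV.margs Z)) → AllComp ws → AgreeOnRespected (γ Z) ws (ts ⟪ γ ⟫A) →
                          fsub (valuationFor xs af ws) (meta Z xs) ⟪ γ ⟫ ≡ meta Z ts ⟪ γ ⟫
        instance≡target ws cws agree = begin
            inst (MV.margs Z) (γ Z) emptyS (fsubA (valuationFor xs af ws) xs ⟪ γ ⟫A)
              ≡⟨ cong (λ z → inst (MV.margs Z) (γ Z) emptyS (z ⟪ γ ⟫A))
                      (fsubA-valuationFor xs af ws (⊵acc-MetaArgsDistinct d (pat-MetaArgsDistinct pa))) ⟩
            inst (MV.margs Z) (γ Z) emptyS (ws ⟪ γ ⟫A)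
              ≡⟨ cong (inst (MV.margs Z) (γ Z) emptyS) (msubA-nometa γ ws (AllComp-noMeta ws cws)) ⟩
            inst (MV.margs Z) (γ Z) emptyS ws
              ≡⟨ inst-respected (MV.margs Z) (γ Z) emptyS emptyS (λ ()) ws (ts ⟪ γ ⟫A) agree ⟩
            inst (MV.margs Z) (γ Z) emptyS (ts ⟪ γ ⟫A) ∎
          where open ≡-Reasoning

  InfChain-mono : ∀ {P P′ R} → (∀ d → P d → P′ d) → InfChain P R → InfChain P′ R
  InfChain-mono P⊆P′ ch = record { dps = dps ; γ = γ ; inP = λ i → P⊆P′ _ (inP i)
                                 ; γ-term = γ-term ; γ-resp = γ-resp ; linked = linked }
    where open InfChain ch

  suffix : ∀ {P P′ R} (ch : InfChain P R) (n : ℕ) → (∀ i → P′ (InfChain.dps ch (i + n))) → InfChain P′ R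
  suffix ch n P′-after = record { dps = λ i → dps (i + n) ; γ = λ i → γ (i + n) ; inP = P′-after
                                ; γ-term = λ i → γ-term (i + n) ; γ-resp = λ i → γ-resp (i + n)
                                ; linked = λ i → linked (i + n) }
    where open InfChain ch

  UComputable-suffix : ∀ {P P′ R} {U : Rule → Set} {C : BSet} (ch : InfChain P R) n P′-after →
                       UComputable ch U C → UComputable (suffix {P′ = P′} ch n P′-after) U C
  UComputable-suffix ch n _ (R⊆U , comp) = R⊆U , λ i → comp (i + n)

  FlagOK-suffix : ∀ {P P′ R} fl (ch : InfChain P R) n P′-after →
                  FlagOK fl ch → FlagOK fl (suffix {P′ = P′} ch n P′-after)
  FlagOK-suffix formative ch n _ fo = λ i → fo (i + n)
  FlagOK-suffix allChains ch n _ _ = tt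

  module Projections (ν : Sym → ℕ) where

    IsJust⇒just : ∀ {A : Set} {m : Maybe A} → IsJust m → Σ A λ a → m ≡ just a
    IsJust⇒just isJust = _ , refl

    projν-∈ : ∀ {τ} (t : Tm [] τ) → IsFunHd (proj₁ (spine t)) → ∀ {B} → projν ν t ≡ just B → B ∈ proj₂ (spine t)
    projν-∈ t h e with funHead-spine t h
    ... | f , sp = lookup1-∈ _ (ν f) (trans (sym (projν-spine ν t sp)) e)

    con-spine-injective : ∀ {f g : Sym} {us vs : List (TmΣ [])} →
                          _≡_ {A = TmΣ [] × List (TmΣ [])} ((_ , con f) , us) ((_ , con g) , vs) → f ≡ g × us ≡ vs
    con-spine-injective refl = refl , refl

    projν-lookup-γΣ : ∀ {ρ} (δ : MSub) (u : Tm [] ρ) {g args C} → spine u ≡ ((_ , con g) , args) →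
                      projν ν u ≡ just C → lookup1 (map (γΣ δ) args) (ν g) ≡ just (γΣ δ C)
    projν-lookup-γΣ δ u {g} {args} sp e =
      trans (lookup1-map (γΣ δ) args (ν g)) (cong (Maybe.map (γΣ δ)) (trans (sym (projν-spine ν u sp)) e))

    Link-projν : ∀ {R σ τ} (t : Tm [] σ) (s : Tm [] τ) (γ γ′ : MSub) {B A} →
                 IsFunHd (proj₁ (spine t)) → IsFunHd (proj₁ (spine s)) → projν ν t ≡ just B → projν ν s ≡ just A →
                 Link R (t ⟪ γ ⟫) (s ⟪ γ′ ⟫) → RedΣ R (γΣ γ B) (γΣ γ′ A)
    Link-projν t s γ γ′ {B} {A} ht hs eB eA (link {f = f} e₁ e₂ pw)
      with funHead-spine t ht | funHead-spine s hs
    ... | fB , spB | fA , spA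
      with con-spine-injective (trans (sym e₁) (spine-msub γ t spB))
         | con-spine-injective (trans (sym e₂) (spine-msub γ′ s spA))
    ... | refl , refl | refl , refl
      with lookup1-pointwise (ν f) pw (projν-lookup-γΣ γ t spB eB)
    ... | y , ly , r with just-injective (trans (sym ly) (projν-lookup-γΣ γ′ s spA eA))
    ... | refl = r

  module StaticCriterion (R U : Rule → Set) (wfU : ∀ r → U r → WfRule r) (C : BSet) (cu : IsCU U C) (fl : Flag)
                         (P₁ P₂ : DP → Set) (wf₁ : ∀ d → P₁ d → WfDP d) (wf₂ : ∀ d → P₂ d → WfDP d)
                         (ν : Sym → ℕ) (pf : ProjFun ν (P₁ ∪P P₂))
                         (sd : ∀ d → P₁ d → StrictlyDecr ν d) (pe : ∀ d → P₂ d → ProjEqual ν d) where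
    open Projections ν
    open Reachability U wfU C (proj₁ cu)
    open Decrease U wfU C (proj₁ cu)

    module _ (fin : FiniteCU P₂ R U C fl) (ch : InfChain (P₁ ∪P P₂) R) (ucomp : UComputable ch U C)
             (flok : FlagOK fl ch) where
      open InfChain ch

      wf : ∀ i → WfDP (dps i)
      wf i = [ wf₁ _ , wf₂ _ ]′ (inP i)

      rhsProj : ℕ → TmΣ []
      rhsProj i = proj₁ (IsJust⇒just (proj₂ (pf _ (inP i))))

      rhsProj≡ : ∀ i → projν ν (DP.rhs (dps i)) ≡ just (rhsProj i)
      rhsProj≡ i = proj₂ (IsJust⇒just (proj₂ (pf _ (inP i))))

      b : ℕ → TmΣ []
      b i = γΣ (γ i) (rhsProj i)

      sort : TmΣ [] → Sort
      sort p = resSort (proj₁ p)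

      rhsProj-unique : ∀ i {B} → projν ν (DP.rhs (dps i)) ≡ just B → rhsProj i ≡ B
      rhsProj-unique i e = just-injective (trans (sym (rhsProj≡ i)) e)

      rhsProj-∈ : ∀ i {B} → projν ν (DP.rhs (dps i)) ≡ just B → B ∈ proj₂ (spine (DP.rhs (dps i)))
      rhsProj-∈ i = projν-∈ (DP.rhs (dps i)) (proj₂ (proj₂ (proj₂ (wf i))))

      lhsProj-∈ : ∀ i {A} → projν ν (DP.lhs (dps i)) ≡ just A → A ∈ proj₂ (spine (DP.lhs (dps i)))
      lhsProj-∈ i = projν-∈ (DP.lhs (dps i)) (proj₂ (proj₁ (proj₂ (wf i))))

      rhsProj-closed : ∀ i {B} → projν ν (DP.rhs (dps i)) ≡ just B → Closed (proj₂ B)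
      rhsProj-closed i e x q = proj₁ (proj₂ (proj₂ (wf i))) x (ArgOf-FV (∈-spine⇒ArgOf _ (rhsProj-∈ i e)) q)

      lhsProj-closed : ∀ i {A} → projν ν (DP.lhs (dps i)) ≡ just A → Closed (proj₂ A)
      lhsProj-closed i e x q = proj₁ (wf i) x (ArgOf-FV (∈-spine⇒ArgOf _ (lhsProj-∈ i e)) q)

      lhsProj-pat : ∀ i {A} → projν ν (DP.lhs (dps i)) ≡ just A → Pat (proj₂ A)
      lhsProj-pat i e = patSp-arg (proj₁ (proj₁ (proj₂ (wf i)))) (lhsProj-∈ i e)

      rhsProj-computableBelow : ∀ i {B} → projν ν (DP.rhs (dps i)) ≡ just B → ComputableBelow (proj₂ B) (γ i)
      rhsProj-computableBelow i e Bc v p r cl =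
        proj₂ ucomp i Bc v [] (b-arg refl (rhsProj-∈ i e) p) r [] (λ x → mk⇔ (λ q → ⊥-elim (cl x q)) (λ ()))

      b⟶*lhsProj : ∀ i {A} → projν ν (DP.lhs (dps (suc i))) ≡ just A →
                   proj₁ (b i) ≡ proj₁ A × b i ⟶* γΣ (γ (suc i)) A
      b⟶*lhsProj i e
        with Link-projν (DP.rhs (dps i)) (DP.lhs (dps (suc i))) (γ i) (γ (suc i)) (proj₂ (proj₂ (proj₂ (wf i))))
                        (proj₂ (proj₁ (proj₂ (wf (suc i))))) (rhsProj≡ i) e (linked i)
      ... | rΣ steps = refl , steps⇒⟶* (R⊆U* steps)
        where
          R⊆U* : ∀ {σ} {s t : Tm [] σ} → Steps R s t → Steps U s t
          R⊆U* ε = ε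
          R⊆U* (st ◅ sts) = proj₁ ucomp st ◅ R⊆U* sts

      b-suc≡ : ∀ i {B} → projν ν (DP.rhs (dps (suc i))) ≡ just B → b (suc i) ≡ γΣ (γ (suc i)) B
      b-suc≡ i e = cong (γΣ (γ (suc i))) (rhsProj-unique (suc i) e)

      weak-step : ∀ i → ¬ P₁ (dps (suc i)) → sort (b i) ⪰ sort (b (suc i)) × b i ⟶* b (suc i)
      weak-step i ¬p₁ with pe _ ([ (λ p₁ → ⊥-elim (¬p₁ p₁)) , (λ p₂ → p₂) ]′ (inP (suc i)))
      ... | a , ea , eb with b⟶*lhsProj i ea
      ... | ty , steps = subst (λ q → sort (b i) ⪰ sort q × b i ⟶* q) (sym (b-suc≡ i eb))
                               (subst (λ σ → sort (b i) ⪰ resSort σ) ty ⪰-refl , steps)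

      strict-step : ∀ i → P₁ (dps (suc i)) →
                    ¬ ¬ (sort (b i) ≻ sort (b (suc i)) ⊎ (sort (b i) ⪰ sort (b (suc i)) × b i ⟶⁺ b (suc i)))
      strict-step i p with sd _ p
      ... | _ , _ , ea , eb , sqΣ {ι} {κ} {aT} {bT} sq with b⟶*lhsProj i ea
      ... | ty , steps =
        ¬¬-map (λ d → subst (λ q → sort (b i) ≻ sort q ⊎ (sort (b i) ⪰ sort q × b i ⟶⁺ q)) (sym (b-suc≡ i eb))
                            (combine d))
               (⊐-decreases sq (lhsProj-closed (suc i) ea) (lhsProj-pat (suc i) ea) (rhsProj-closed (suc i) eb)
                            (γ (suc i)) (rhsProj-computableBelow (suc i) eb))
        where
          sort-b : sort (b i) ≡ ι
          sort-b = cong resSort ty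
          combine : Decreases aT bT (γ (suc i)) → sort (b i) ≻ κ ⊎ (sort (b i) ⪰ κ × b i ⟶⁺ (base κ , bT ⟪ γ (suc i) ⟫))
          combine (inj₁ lt) = inj₁ (subst (_≻ κ) (sym sort-b) lt)
          combine (inj₂ (ge , pl)) = inj₂ (subst (_⪰ κ) (sym sort-b) ge , Star-Plus-trans steps pl)

      strict-acc : ∀ i → P₁ (dps i) → Acc (λ y x → x ⟶ y) (b i)
      strict-acc i p with sd _ p
      ... | _ , _ , _ , eb , sqΣ {t = bT} _ =
        subst (Acc _) (sym (cong (γΣ (γ i)) (rhsProj-unique i eb))) (acc-⟶ (accessible (bT ⟪ γ i ⟫) inC))
        where
          inC : C (bT ⟪ γ i ⟫)
          inC = rhsProj-computableBelow i eb (DP.conds (dps i)) bT b-refl (γ-resp i) (rhsProj-closed i eb)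
          accessible : ∀ {κ} (s : Tm [] (base κ)) → C s → Acc (λ q p → UStep U C p q) (κ , s)
          accessible s c = proj₁ (Equivalence.to (proj₂ cu s (proj₁ (proj₁ cu) s c)) c)

      strict-io : InfinitelyOften (λ i → P₁ (dps i))
      strict-io i none =
        fin (suffix ch (suc i) P₂-after , UComputable-suffix {P′ = P₂} ch (suc i) P₂-after ucomp
            , FlagOK-suffix {P′ = P₂} fl ch (suc i) P₂-after flok)
        where
          P₂-after : ∀ k → P₂ (dps (k + suc i))
          P₂-after k =
            [ (λ p → ⊥-elim (none (k , subst (λ n → P₁ (dps n)) (+-suc k i) p))) , (λ p → p) ]′ (inP (k + suc i))

      no-computable-chain : ⊥
      no-computable-chain =
        DescendingSequences.no-descending-sequence sort _⟶_ b (λ i → P₁ (dps i))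
          strict-io strict-acc strict-step weak-step

theorem63 : (Sg : Sig) → let open Framework Sg in
    (R U : Rule → Set) → (∀ r → R r → WfRule r) → (∀ r → U r → WfRule r) →
    FreshSyms R →
    (C : BSet) → IsCU U C →
    (fl : Flag) →
    (P₁ P₂ : DP → Set) → (∀ d → P₁ d → WfDP d) → (∀ d → P₂ d → WfDP d) →
    (∀ d → P₁ d → P₂ d → ⊥) →
    (ν : Sig.Sym Sg → ℕ) → ProjFun ν (P₁ ∪P P₂) →
    (∀ d → P₁ d → StrictlyDecr ν d) →
    (∀ d → P₂ d → ProjEqual ν d) →
    (FiniteCU P₂ R U C fl → FiniteCU (P₁ ∪P P₂) R U C fl)
    × (InfiniteDP P₂ R → InfiniteDP (P₁ ∪P P₂) R)
theorem63 Sg R U _ wfU _ C cu fl P₁ P₂ wf₁ wf₂ _ ν pf sd pe = sound , complete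
  where
    open Framework Sg

    sound : FiniteCU P₂ R U C fl → FiniteCU (P₁ ∪P P₂) R U C fl
    sound fin (ch , ucomp , flok) =
      StaticCriterion.no-computable-chain Sg R U wfU C cu fl P₁ P₂ wf₁ wf₂ ν pf sd pe fin ch ucomp flok

    complete : InfiniteDP P₂ R → InfiniteDP (P₁ ∪P P₂) R
    complete (inj₁ nonterm) = inj₁ nonterm
    complete (inj₂ ch) = inj₂ (InfChain-mono Sg (λ { d (p₂ , cons) → inj₂ p₂ , cons }) ch)
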